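{- Let $\mathcal E$ be an exchangeability system for a noncommutative probability space $(\mathcal A,\phi)$, let $X_1,\dots,X_n\in\mathcal A$, and let $Y_i=\sum_{j=1}^n\alpha_{ij}X_j+\beta_i\,1$, $i=1,\dots,m$, with scalars $\alpha_{ij},\beta_i\in\mathbb C$. Then for $m\ge2$ the cumulant $K_m(Y_1,\dots,Y_m)$ does not depend on the constants $\beta_i$ and $$K_m(Y_1,\dots,Y_m)=\sum_{j_1,\dots,j_m=1}^n\alpha_{1,j_1}\cdots\alpha_{m,j_m}K_m(X_{j_1},\dots,X_{j_m}).$$ Analogously, for every partition $\pi\in\Pi_m$ without singleton blocks, $K_\pi(Y_1,\dots,Y_m)=\sum_{j_1,\dots,j_m}\alpha_{1,j_1}\cdots\alpha_{m,j_m}K_\pi(X_{j_1},\dots,X_{j_m})$.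
   Context: A noncommutative probability space is a pair $(\mathcal A,\phi)$ of a complex unital algebra $\mathcal A$ and a unital linear functional $\phi$. An exchangeability system $\mathcal E$ for $(\mathcal A,\phi)$ consists of a noncommutative probability space $(\mathcal U,\tilde\phi)$ and embeddings (injective unital homomorphisms) $\iota_k:\mathcal A\to\mathcal U$, $k\in\mathbb N$, with $\tilde\phi\circ\iota_k=\phi$; write $X^{(k)}=\iota_k(X)$. It is required that for all $n$, all $X_1,\dots,X_n\in\mathcal A$, all indices $i_1,\dots,i_n\in\mathbb N$ and every permutation $\sigma$ of $\mathbb N$: $\tilde\phi(X_1^{(i_1)}\cdots X_n^{(i_n)})=\tilde\phi(X_1^{(\sigma(i_1))}\cdots X_n^{(\sigma(i_n))})$. Thus this value depends only on the kernel of $j\mapsto i_j$; for $\sigma\in\Pi_m$ (set partitions of $[m]$, ordered by refinement, Möbius function $\mu$) denote it $\phi_\sigma$. The cumulant is $K_m(Y_1,\dots,Y_m)=\frac1m\tilde\phi(Y_1^\omega\cdots Y_m^\omega)$ with $\omega$ a primitive $m$-th root of unity and $Y_j^\omega=\sum_{k=1}^m\omega^kY_j^{(k)}$; the partitioned cumulant is $K_\pi=\sum_{\sigma\le\pi}\phi_\sigma\,\mu(\sigma,\pi)$. -}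

module Defs where

open import Level using (Level; _⊔_) renaming (suc to lsuc)
open import Algebra.Bundles using (CommutativeRing; Ring)
open import Data.Nat as ℕ using (ℕ; zero; suc; _≡ᵇ_; _<_)
open import Data.Fin using (Fin; zero; suc; toℕ)
open import Data.Bool using (Bool; true; false; _∧_; _∨_; not; if_then_else_)
open import Data.List using (List; []; _∷_; _++_; map; concatMap; upTo; foldr)
open import Data.List.Properties using (≡-dec)
open import Data.Product using (_×_; _,_; proj₁; proj₂; ∃)
open import Relation.Nullary using (¬_)
open import Relation.Nullary.Decidable using (⌊_⌋)
open import Relation.Binary.PropositionalEquality using (_≡_; _≢_)
open import Function.Bundles using (_↔_; Inverse)

-- Scalar field (the paper uses ℂ; the standard library has no ℂ, so we
-- work over an arbitrary field).

record Field c ℓ : Set (lsuc (c ⊔ ℓ)) where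
  field
    commutativeRing : CommutativeRing c ℓ
  open CommutativeRing commutativeRing public
  field
    0≉1     : ¬ (0# ≈ 1#)
    inverse : ∀ x → ¬ (x ≈ 0#) → ∃ λ y → (x * y) ≈ 1#

module RingOps {a ℓa} (R : Ring a ℓa) where
  open Ring R using (Carrier; _+_; _*_; 0#; 1#)

  sumFin : ∀ {n} → (Fin n → Carrier) → Carrier
  sumFin {zero}  f = 0#
  sumFin {suc n} f = f zero + sumFin (λ j → f (suc j))

  prodFin : ∀ {n} → (Fin n → Carrier) → Carrier
  prodFin {zero}  f = 1#
  prodFin {suc n} f = f zero * prodFin (λ j → f (suc j))

  sumList : List Carrier → Carrier
  sumList = foldr _+_ 0#

  pow : Carrier → ℕ → Carrier
  pow x zero    = 1#
  pow x (suc k) = x * pow x k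

  fromℕ : ℕ → Carrier
  fromℕ zero    = 0#
  fromℕ (suc k) = 1# + fromℕ k

  sumMulti : ∀ m n → ((Fin m → Fin n) → Carrier) → Carrier
  sumMulti zero    n F = F (λ ())
  sumMulti (suc m) n F =
    sumFin {n} (λ j → sumMulti m n (λ g → F (λ { zero → j ; (suc i) → g i })))

-- Set partitions of [m] = {0,…,m-1}, encoded canonically as restricted
-- growth strings: the list of block labels (b₀,…,b_{m-1}) with b₀ = 0 and
-- b_i ≤ 1 + max(b₀,…,b_{i-1}).  Two points are in the same block iff they
-- have the same label.

-- all restricted growth strings of length m, with their number of blocks
rgs : ℕ → List (List ℕ × ℕ)
rgs zero    = ([] , 0) ∷ []
rgs (suc m) = concatMap
  (λ p → map (λ c → (proj₁ p ++ c ∷ [])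
                    , (if c ≡ᵇ proj₂ p then suc (proj₂ p) else proj₂ p))
             (upTo (suc (proj₂ p))))
  (rgs m)

Partitions : ℕ → List (List ℕ)
Partitions m = map proj₁ (rgs m)

lab : List ℕ → ℕ → ℕ
lab []       i       = 0
lab (x ∷ xs) zero    = x
lab (x ∷ xs) (suc i) = lab xs i

allB : (ℕ → Bool) → List ℕ → Bool
allB p = foldr (λ x b → p x ∧ b) true

refines : ℕ → List ℕ → List ℕ → Bool
refines m σ π = allB (λ i → allB (λ j → not (lab σ i ≡ᵇ lab σ j) ∨ (lab π i ≡ᵇ lab π j))
                               (upTo m))
                    (upTo m)

eqP : List ℕ → List ℕ → Bool
eqP σ π = ⌊ ≡-dec ℕ._≟_ σ π ⌋

NoSingletons : ℕ → List ℕ → Set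
NoSingletons m π = ∀ i → i < m → ∃ λ j → j < m × j ≢ i × lab π j ≡ lab π i

module Theory {c ℓ} (K : Field c ℓ) where
  module K = Field K
  open RingOps K.ring public using () renaming
    (sumFin to sumK; prodFin to prodK; sumList to sumListK; pow to powK;
     fromℕ to fromℕK; sumMulti to sumMultiK)

  -- Möbius function of Π_m, by the defining recursion
  --   μ(σ,σ) = 1,  μ(σ,π) = - Σ_{σ ≤ ρ < π} μ(σ,ρ)  (σ < π),  μ(σ,π) = 0 (σ ≰ π),
  -- computed with a recursion-depth bound (any bound ≥ m - 1 suffices,
  -- since chains in Π_m have length ≤ m - 1).
  mobius′ : ℕ → ℕ → List ℕ → List ℕ → K.Carrier
  mobius′ zero    m σ π = if eqP σ π then K.1# else K.0#
  mobius′ (suc f) m σ π =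
    if eqP σ π then K.1#
    else if refines m σ π
      then K.- sumListK (map (λ ρ → if refines m σ ρ ∧ refines m ρ π ∧ not (eqP ρ π)
                                     then mobius′ f m σ ρ else K.0#)
                             (Partitions m))
      else K.0#

  mobius : ℕ → List ℕ → List ℕ → K.Carrier
  mobius m = mobius′ m m

  PrimitiveRoot : ℕ → K.Carrier → Set ℓ
  PrimitiveRoot m ω = (powK ω m K.≈ K.1#) × (∀ k → 0 < k → k < m → ¬ (powK ω k K.≈ K.1#))

  record Alg a ℓa : Set (c ⊔ ℓ ⊔ lsuc (a ⊔ ℓa)) where
    field
      ring : Ring a ℓa
    open Ring ring public hiding (zero)
    infixr 7 _·_
    field
      _·_        : K.Carrier → Carrier → Carrier
      ·-cong     : ∀ {k k′ x y} → k K.≈ k′ → x ≈ y → (k · x) ≈ (k′ · y)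
      ·-distribˡ : ∀ k x y → (k · (x + y)) ≈ ((k · x) + (k · y))
      ·-distribʳ : ∀ k l x → ((k K.+ l) · x) ≈ ((k · x) + (l · x))
      ·-assoc    : ∀ k l x → ((k K.* l) · x) ≈ (k · (l · x))
      ·-identity : ∀ x → (K.1# · x) ≈ x
      ·-*ˡ       : ∀ k x y → ((k · x) * y) ≈ (k · (x * y))
      ·-*ʳ       : ∀ k x y → (x * (k · y)) ≈ (k · (x * y))
    open RingOps ring public using (sumFin; prodFin)

  record NCPS a ℓa : Set (c ⊔ ℓ ⊔ lsuc (a ⊔ ℓa)) where
    field
      alg : Alg a ℓa
    open Alg alg public
    field
      φ      : Carrier → K.Carrier
      φ-cong : ∀ {x y} → x ≈ y → φ x K.≈ φ y
      φ-+    : ∀ x y → φ (x + y) K.≈ (φ x K.+ φ y)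
      φ-·    : ∀ k x → φ (k · x) K.≈ (k K.* φ x)
      φ-1    : φ 1# K.≈ K.1#

  record Embedding {a ℓa b ℓb} (A : Alg a ℓa) (B : Alg b ℓb)
         : Set (c ⊔ a ⊔ ℓa ⊔ b ⊔ ℓb) where
    private
      module A = Alg A
      module B = Alg B
    field
      to        : A.Carrier → B.Carrier
      cong      : ∀ {x y} → x A.≈ y → to x B.≈ to y
      hom-+     : ∀ x y → to (x A.+ y) B.≈ (to x B.+ to y)
      hom-·     : ∀ k x → to (k A.· x) B.≈ (k B.· to x)
      hom-*     : ∀ x y → to (x A.* y) B.≈ (to x B.* to y)
      hom-1     : to A.1# B.≈ B.1#
      injective : ∀ {x y} → to x B.≈ to y → x A.≈ y

  record ExchSystem {a ℓa} (P : NCPS a ℓa) u ℓu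
         : Set (c ⊔ ℓ ⊔ a ⊔ ℓa ⊔ lsuc (u ⊔ ℓu)) where
    private module P = NCPS P
    field
      U : NCPS u ℓu
    private module U = NCPS U
    field
      ι      : ℕ → Embedding P.alg U.alg
    _⁽_⁾ : P.Carrier → ℕ → U.Carrier
    X ⁽ k ⁾ = Embedding.to (ι k) X
    field
      ι-φ    : ∀ k X → U.φ (X ⁽ k ⁾) K.≈ P.φ X
      exch   : ∀ n (X : Fin n → P.Carrier) (i : Fin n → ℕ) (σ : ℕ ↔ ℕ) →
               U.φ (U.prodFin (λ j → X j ⁽ i j ⁾))
                 K.≈ U.φ (U.prodFin (λ j → X j ⁽ Inverse.to σ (i j) ⁾))

    -- φ_σ(Y₁,…,Y_m) = φ̃(Y₁^{(i₁)} ⋯ Y_m^{(i_m)}) with ker i = σ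
    -- (we take i_j = label of j in σ)
    φₚ : ∀ {m} → List ℕ → (Fin m → P.Carrier) → K.Carrier
    φₚ σ Y = U.φ (U.prodFin (λ j → Y j ⁽ lab σ (toℕ j) ⁾))

    rootSum : ℕ → K.Carrier → P.Carrier → U.Carrier
    rootSum m ω Y = U.sumFin {m} (λ k → powK ω (suc (toℕ k)) U.· (Y ⁽ suc (toℕ k) ⁾))

    -- K_m(Y₁,…,Y_m) = (1/m) φ̃(Y₁^ω ⋯ Y_m^ω); minv is the inverse of m in K
    cumulant : (m : ℕ) → (ω minv : K.Carrier) → (Fin m → P.Carrier) → K.Carrier
    cumulant m ω minv Y = minv K.* U.φ (U.prodFin (λ j → rootSum m ω (Y j)))

    partCumulant : (m : ℕ) → List ℕ → (Fin m → P.Carrier) → K.Carrier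
    partCumulant m π Y =
      sumListK (map (λ σ → if refines m σ π then φₚ σ Y K.* mobius m σ π else K.0#)
                    (Partitions m))

module Submission where

-- Both cumulants are multilinear, since φ̃ is linear and each ι_k is an algebra homomorphism, so
-- expanding Y_i = Σ_j α_ij X_j + β_i 1 gives the stated formula once every term with the unit 1 in
-- some slot is shown to vanish.  For K_m this is because 1^ω = (ω + ω² + ⋯ + ωᵐ) 1 = 0 when ω is a
-- primitive m-th root of unity and m ≥ 2.  For K_π, putting 1 in slot i makes the moments φ_σ blind
-- to the block of σ that contains i (ι_k(1) = 1), while exchangeability makes them depend only on
-- the kernel of the labelling.  Möbius inversion compares π with the partition π° in which i is
-- split off: both have the same moment, and the refinements of π° are exactly the refinements of π
-- in which i is a singleton.  Induction on the number of blocks then gives K_π = 0 whenever i is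
-- not a singleton of π, in particular when π has no singletons.

open import Defs
open import Data.Nat using (ℕ; _≤_; suc; s≤s; z≤n)
open import Data.Fin using (Fin)
open import Data.List using (List)
open import Data.List.Membership.Propositional using (_∈_)
open import Data.Product using (_×_; _,_)
open import Algebra.Bundles using (CommutativeRing; Ring)

module RestrictedGrowth where

  open import Data.Nat using (zero; _<_; _⊔_; _≡ᵇ_; _≟_; anyUpTo?)
  open import Data.Nat.Properties
  open import Data.Bool using (Bool; true; false; if_then_else_; not; _∨_; T)
  open import Data.Empty using (⊥-elim)
  open import Data.List using ([]; _∷_; _++_; _∷ʳ_; length; map; concat; upTo)
  open import Data.List.Properties using (≡-dec; length-++; ∷ʳ-injectiveˡ; ∷ʳ-injectiveʳ; map-concatMap; map-∘; map-cong)
  open import Data.List.Membership.Propositional.Properties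
    using (∈-map⁺; ∈-map⁻; ∈-concatMap⁺; ∈-concatMap⁻; ∈-upTo⁺; ∈-upTo⁻)
  open import Data.List.Membership.Propositional using (find; lose)
  open import Data.List.Relation.Unary.Any using (here; there)
  import Data.List.Relation.Unary.All as All
  import Data.List.Relation.Unary.AllPairs as AllPairs
  import Data.List.Relation.Unary.AllPairs.Properties as AllPairs
  import Data.List.Relation.Unary.All.Properties as All
  open import Data.List.Relation.Unary.Unique.Propositional using (Unique)
  import Data.List.Relation.Unary.Unique.Propositional.Properties as Unique
  open import Data.List.Relation.Binary.Disjoint.Propositional using (Disjoint)
  open import Data.Product using (∃; _,_; proj₁; proj₂)
  open import Data.Sum using (inj₁; inj₂)
  open import Function.Base using (_∘_; case_of_)
  open import Function.Bundles using (_↔_; Inverse; Injection; mk↔ₛ′)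
  open import Function.Properties.Inverse using (↔⇒↣)
  open import Function.Construct.Identity using (↔-id)
  open import Function.Construct.Composition using (_↔-∘_)
  open import Relation.Nullary using (¬_; yes; no)
  open import Relation.Binary.PropositionalEquality

  blocks : List ℕ → ℕ
  blocks []       = 0
  blocks (b ∷ bs) = suc b ⊔ blocks bs

  blocks-∷ʳ : ∀ p c → blocks (p ∷ʳ c) ≡ blocks p ⊔ suc c
  blocks-∷ʳ []      c = ⊔-comm (suc c) 0
  blocks-∷ʳ (b ∷ p) c = trans (cong (suc b ⊔_) (blocks-∷ʳ p c)) (sym (⊔-assoc (suc b) (blocks p) (suc c)))

  lab<blocks : ∀ p {j} → j < length p → lab p j < blocks p
  lab<blocks (b ∷ p) {zero}  _       = m≤m⊔n (suc b) (blocks p)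
  lab<blocks (b ∷ p) {suc j} (s≤s j<) = ≤-trans (lab<blocks p j<) (m≤n⊔m (suc b) (blocks p))

  lab-++ˡ : ∀ p ys {j} → j < length p → lab (p ++ ys) j ≡ lab p j
  lab-++ˡ (b ∷ p) ys {zero}  _        = refl
  lab-++ˡ (b ∷ p) ys {suc j} (s≤s j<) = lab-++ˡ p ys j<

  lab-++-length : ∀ p c ys → lab (p ++ c ∷ ys) (length p) ≡ c
  lab-++-length []      c ys = refl
  lab-++-length (b ∷ p) c ys = lab-++-length p c ys

  data Canonical : ℕ → List ℕ → Set where
    []     : Canonical 0 []
    extend : ∀ {m q c} → Canonical m q → c ≤ blocks q → Canonical (suc m) (q ∷ʳ c)

  canonical-length : ∀ {m p} → Canonical m p → length p ≡ m
  canonical-length []                    = refl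
  canonical-length (extend {q = q} {c} cq _) =
    trans (length-++ q {c ∷ []}) (trans (+-comm (length q) 1) (cong suc (canonical-length cq)))

  lab<blocks-canonical : ∀ {m q} → Canonical m q → ∀ {j} → j < m → lab q j < blocks q
  lab<blocks-canonical {q = q} cq {j} j< = lab<blocks q (subst (j <_) (sym (canonical-length cq)) j<)

  module _ {m q} {c : ℕ} (cq : Canonical m q) where

    lab-∷ʳ-< : ∀ {j} → j < m → lab (q ∷ʳ c) j ≡ lab q j
    lab-∷ʳ-< {j} j< = lab-++ˡ q _ (subst (j <_) (sym (canonical-length cq)) j<)

    lab-∷ʳ-last : lab (q ∷ʳ c) m ≡ c
    lab-∷ʳ-last = subst (λ k → lab (q ∷ʳ c) k ≡ c) (canonical-length cq) (lab-++-length q c [])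

  data BlockGrowth (q : List ℕ) (c : ℕ) : Set where
    newBlock : c ≡ blocks q → blocks (q ∷ʳ c) ≡ suc (blocks q) → BlockGrowth q c
    oldBlock : c < blocks q → blocks (q ∷ʳ c) ≡ blocks q → BlockGrowth q c

  blockGrowth : ∀ q {c} → c ≤ blocks q → BlockGrowth q c
  blockGrowth q {c} c≤ with m≤n⇒m<n∨m≡n c≤
  ... | inj₁ c<    = oldBlock c< (trans (blocks-∷ʳ q c) (m≥n⇒m⊔n≡m c<))
  ... | inj₂ refl  = newBlock refl (trans (blocks-∷ʳ q c) (m≤n⇒m⊔n≡n (n≤1+n _)))

  canonical-blocks-used : ∀ {m p} → Canonical m p → ∀ {b} → b < blocks p → ∃ λ j → j < m × lab p j ≡ b
  canonical-blocks-used (extend {m} {q} {c} cq c≤) {b} b< with blockGrowth q c≤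
  ... | oldBlock _ eq = earlier (subst (b <_) eq b<)
    where
    earlier : b < blocks q → ∃ λ j → j < suc m × lab (q ∷ʳ c) j ≡ b
    earlier b<q = let j , j< , e = canonical-blocks-used cq b<q in
                  j , m<n⇒m<1+n j< , trans (lab-∷ʳ-< cq j<) e
  ... | newBlock c≡ eq with m≤n⇒m<n∨m≡n (≤-pred (subst (b <_) eq b<))
  ...   | inj₁ b<q = let j , j< , e = canonical-blocks-used cq b<q in
                     j , m<n⇒m<1+n j< , trans (lab-∷ʳ-< cq j<) e
  ...   | inj₂ refl = m , n<1+n m , trans (lab-∷ʳ-last cq) c≡

  canonical-blocks≤ : ∀ {m p} → Canonical m p → blocks p ≤ m
  canonical-blocks≤ []                     = z≤n
  canonical-blocks≤ (extend {q = q} cq c≤) with blockGrowth q c≤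
  ... | newBlock _ eq = ≤-trans (≤-reflexive eq) (s≤s (canonical-blocks≤ cq))
  ... | oldBlock _ eq = ≤-trans (≤-reflexive eq) (m≤n⇒m≤1+n (canonical-blocks≤ cq))

  ≡ᵇ-refl : ∀ n → (n ≡ᵇ n) ≡ true
  ≡ᵇ-refl zero    = refl
  ≡ᵇ-refl (suc n) = ≡ᵇ-refl n

  ≡ᵇ-sound : ∀ {a b} → (a ≡ᵇ b) ≡ true → a ≡ b
  ≡ᵇ-sound {a} {b} e = ≡ᵇ⇒≡ a b (subst T (sym e) _)

  -- The counter stored next to a string in rgs is its number of blocks.
  rgs-counter : ∀ q {c} → c ≤ blocks q →
    (if c ≡ᵇ blocks q then suc (blocks q) else blocks q) ≡ blocks (q ∷ʳ c)
  rgs-counter q {c} c≤ with blockGrowth q c≤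
  ... | newBlock refl e rewrite ≡ᵇ-refl (blocks q) = sym e
  ... | oldBlock c< e with c ≡ᵇ blocks q in c≡ᵇ
  ...   | true  = ⊥-elim (<⇒≢ c< (≡ᵇ-sound c≡ᵇ))
  ...   | false = sym e

  rgs-suc⁻ : ∀ {m y} → y ∈ rgs (suc m) →
    ∃ λ x → x ∈ rgs m × ∃ λ c → c ≤ proj₂ x ×
      y ≡ (proj₁ x ∷ʳ c , (if c ≡ᵇ proj₂ x then suc (proj₂ x) else proj₂ x))
  rgs-suc⁻ {m} y∈ with find (∈-concatMap⁻ _ {xs = rgs m} y∈)
  ... | x , x∈ , y∈x with ∈-map⁻ _ y∈x
  ...   | c , c∈ , refl = x , x∈ , c , ≤-pred (∈-upTo⁻ c∈) , refl

  rgs-suc⁺ : ∀ {m x c} → x ∈ rgs m → c ≤ proj₂ x →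
    (proj₁ x ∷ʳ c , (if c ≡ᵇ proj₂ x then suc (proj₂ x) else proj₂ x)) ∈ rgs (suc m)
  rgs-suc⁺ {m} x∈ c≤ = ∈-concatMap⁺ _ {xs = rgs m} (lose x∈ (∈-map⁺ _ (∈-upTo⁺ (s≤s c≤))))

  rgs⇒canonical : ∀ m {x} → x ∈ rgs m → proj₂ x ≡ blocks (proj₁ x) × Canonical m (proj₁ x)
  rgs⇒canonical zero    (here refl) = refl , []
  rgs⇒canonical (suc m) y∈ with rgs-suc⁻ {m} y∈
  ... | (q , _) , x∈ , c , c≤ , refl with rgs⇒canonical m x∈
  ...   | refl , cq = rgs-counter q c≤ , extend cq c≤

  canonical⇒rgs : ∀ {m p} → Canonical m p → (p , blocks p) ∈ rgs m
  canonical⇒rgs []                     = here refl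
  canonical⇒rgs (extend {m} {q} {c} cq c≤) =
    subst (λ b → (q ∷ʳ c , b) ∈ rgs (suc m)) (rgs-counter q c≤) (rgs-suc⁺ {m} (canonical⇒rgs cq) c≤)

  ∈Partitions⇒Canonical : ∀ {m p} → p ∈ Partitions m → Canonical m p
  ∈Partitions⇒Canonical {m} p∈ with ∈-map⁻ proj₁ p∈
  ... | _ , x∈ , refl = proj₂ (rgs⇒canonical m x∈)

  Canonical⇒∈Partitions : ∀ {m p} → Canonical m p → p ∈ Partitions m
  Canonical⇒∈Partitions cp = ∈-map⁺ proj₁ (canonical⇒rgs cp)

  Partitions-unique : ∀ m → Unique (Partitions m)
  Partitions-unique zero    = All.[] AllPairs.∷ AllPairs.[]
  Partitions-unique (suc m) = subst Unique (sym Partitions-suc)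
    (Unique.concat⁺ (All.map⁺ (All.tabulate λ {x} _ → extensions-unique x))
                    (AllPairs.map⁺ (AllPairs.map extensions-disjoint (AllPairs.map⁻ (Partitions-unique m)))))
    where
    extensions : List ℕ × ℕ → List (List ℕ)
    extensions (q , b) = map (q ∷ʳ_) (upTo (suc b))

    Partitions-suc : Partitions (suc m) ≡ concat (map extensions (rgs m))
    Partitions-suc = trans (map-concatMap proj₁ _ (rgs m))
                           (cong concat (map-cong (λ x → sym (map-∘ (upTo (suc (proj₂ x))))) (rgs m)))

    extensions-unique : ∀ x → Unique (extensions x)
    extensions-unique (q , b) = Unique.map⁺ (∷ʳ-injectiveʳ q q) (Unique.upTo⁺ (suc b))

    extensions-disjoint : ∀ {x y} → proj₁ x ≢ proj₁ y → Disjoint (extensions x) (extensions y)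
    extensions-disjoint {q , _} {q′ , _} q≢q′ (v∈ , v∈′) with ∈-map⁻ _ v∈ | ∈-map⁻ _ v∈′
    ... | _ , _ , refl | _ , _ , e = q≢q′ (∷ʳ-injectiveˡ q q′ e)

  eqP-sound : ∀ {σ π} → eqP σ π ≡ true → σ ≡ π
  eqP-sound {σ} {π} e with ≡-dec _≟_ σ π
  ... | yes σ≡π = σ≡π

  eqP-refl : ∀ σ → eqP σ σ ≡ true
  eqP-refl σ with ≡-dec _≟_ σ σ
  ... | yes _  = refl
  ... | no σ≢σ = ⊥-elim (σ≢σ refl)

  eqP-false : ∀ {σ π} → eqP σ π ≡ false → σ ≢ π
  eqP-false {σ} e refl with trans (sym e) (eqP-refl σ)
  ... | ()

  record Refines (m : ℕ) (σ π : List ℕ) : Set where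
    constructor refining
    field sameBlock : ∀ {j k} → j < m → k < m → lab σ j ≡ lab σ k → lab π j ≡ lab π k
  open Refines public

  Refines-refl : ∀ {m σ} → Refines m σ σ
  Refines-refl = refining λ _ _ e → e

  Refines-trans : ∀ {m σ ρ π} → Refines m σ ρ → Refines m ρ π → Refines m σ π
  Refines-trans σ⊑ρ ρ⊑π = refining λ j< k< e → sameBlock ρ⊑π j< k< (sameBlock σ⊑ρ j< k< e)

  allB-sound : ∀ (p : ℕ → Bool) xs → allB p xs ≡ true → ∀ {x} → x ∈ xs → p x ≡ true
  allB-sound p (y ∷ xs) e (here refl) with p y
  ... | true = refl
  allB-sound p (y ∷ xs) e (there x∈) with p y
  ... | true = allB-sound p xs e x∈

  allB-complete : ∀ (p : ℕ → Bool) xs → (∀ {x} → x ∈ xs → p x ≡ true) → allB p xs ≡ true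
  allB-complete p []       _ = refl
  allB-complete p (y ∷ xs) h rewrite h (here refl) = allB-complete p xs (h ∘ there)

  refines-sound : ∀ m σ π → refines m σ π ≡ true → Refines m σ π
  refines-sound m σ π e = refining λ j< k< σjk →
    pair σjk (allB-sound _ (upTo m) (allB-sound _ (upTo m) e (∈-upTo⁺ j<)) (∈-upTo⁺ k<))
    where
    pair : ∀ {j k} → lab σ j ≡ lab σ k → (not (lab σ j ≡ᵇ lab σ k) ∨ (lab π j ≡ᵇ lab π k)) ≡ true →
           lab π j ≡ lab π k
    pair {k = k} σjk h rewrite σjk | ≡ᵇ-refl (lab σ k) = ≡ᵇ-sound h

  refines-complete : ∀ m σ π → Refines m σ π → refines m σ π ≡ true
  refines-complete m σ π σ⊑π =
    allB-complete _ (upTo m) λ j∈ → allB-complete _ (upTo m) λ k∈ → pair (∈-upTo⁻ j∈) (∈-upTo⁻ k∈)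
    where
    pair : ∀ {j k} → j < m → k < m → (not (lab σ j ≡ᵇ lab σ k) ∨ (lab π j ≡ᵇ lab π k)) ≡ true
    pair {j} {k} j< k< with lab σ j ≡ᵇ lab σ k in e
    ... | false = refl
    ... | true rewrite sameBlock σ⊑π j< k< (≡ᵇ-sound e) | ≡ᵇ-refl (lab π k) = refl

  refines-false : ∀ m σ π → refines m σ π ≡ false → ¬ Refines m σ π
  refines-false m σ π e σ⊑π with trans (sym e) (refines-complete m σ π σ⊑π)
  ... | ()

  module _ {m p q c d} (cp : Canonical m p) (cq : Canonical m q)
           (p⊑q : Refines (suc m) (p ∷ʳ c) (q ∷ʳ d)) where

    Refines-init : Refines m p q
    Refines-init = refining λ j< k< e →
      trans (sym (lab-∷ʳ-< cq j<))
        (trans (sameBlock p⊑q (m<n⇒m<1+n j<) (m<n⇒m<1+n k<)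
                    (trans (lab-∷ʳ-< cp j<) (trans e (sym (lab-∷ʳ-< cp k<)))))
               (lab-∷ʳ-< cq k<))

    Refines-last : ∀ {j} → j < m → lab p j ≡ c → lab q j ≡ d
    Refines-last j< e =
      trans (sym (lab-∷ʳ-< cq j<))
        (trans (sameBlock p⊑q (m<n⇒m<1+n j<) (n<1+n m) (trans (lab-∷ʳ-< cp j<) (trans e (sym (lab-∷ʳ-last cp)))))
               (lab-∷ʳ-last cq))

  blocks-antitone : ∀ {m σ π} → Canonical m σ → Canonical m π → Refines m σ π →
    blocks π ≤ blocks σ × (blocks π ≡ blocks σ → π ≡ σ)
  blocks-antitone [] [] _ = ≤-refl , λ _ → refl
  blocks-antitone {suc m} (extend {q = p} {c} cp c≤) (extend {q = q} {d} cq d≤) σ⊑π =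
    step (blockGrowth p c≤) (blockGrowth q d≤)
    where
    IH = blocks-antitone cp cq (Refines-init cp cq σ⊑π)

    step : BlockGrowth p c → BlockGrowth q d →
      blocks (q ∷ʳ d) ≤ blocks (p ∷ʳ c) × (blocks (q ∷ʳ d) ≡ blocks (p ∷ʳ c) → q ∷ʳ d ≡ p ∷ʳ c)
    step (newBlock c≡ ep) (newBlock d≡ eq) =
      ≤-trans (≤-reflexive eq) (≤-trans (s≤s (proj₁ IH)) (≤-reflexive (sym ep))) ,
      λ e → let q≡p = proj₂ IH (suc-injective (trans (sym eq) (trans e ep))) in
            cong₂ _∷ʳ_ q≡p (trans d≡ (trans (cong blocks q≡p) (sym c≡)))
    step (newBlock _ ep) (oldBlock _ eq) =
      ≤-trans (≤-reflexive eq) (≤-trans (m≤n⇒m≤1+n (proj₁ IH)) (≤-reflexive (sym ep))) ,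
      λ e → ⊥-elim (1+n≰n (≤-trans (≤-reflexive (trans (sym ep) (trans (sym e) eq))) (proj₁ IH)))
    step (oldBlock c< _) (newBlock d≡ _) =
      let j , j< , e = canonical-blocks-used cp c< in
      ⊥-elim (<⇒≢ (lab<blocks-canonical cq j<) (trans (Refines-last cp cq σ⊑π j< e) d≡))
    step (oldBlock c< ep) (oldBlock _ eq) =
      ≤-trans (≤-reflexive eq) (≤-trans (proj₁ IH) (≤-reflexive (sym ep))) ,
      λ e → let q≡p = proj₂ IH (trans (sym eq) (trans e ep))
                j , j< , lpj≡c = canonical-blocks-used cp c< in
            cong₂ _∷ʳ_ q≡p (trans (sym (Refines-last cp cq σ⊑π j< lpj≡c))
                                  (trans (cong (λ r → lab r j) q≡p) lpj≡c))

  Refines-antisym : ∀ {m σ π} → Canonical m σ → Canonical m π → Refines m σ π → Refines m π σ → σ ≡ π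
  Refines-antisym cσ cπ σ⊑π π⊑σ =
    sym (proj₂ (blocks-antitone cσ cπ σ⊑π) (≤-antisym (proj₁ (blocks-antitone cσ cπ σ⊑π))
                                                     (proj₁ (blocks-antitone cπ cσ π⊑σ))))

  Refines-strict⇒blocks-< : ∀ {m σ π} → Canonical m σ → Canonical m π → Refines m σ π → σ ≢ π →
    blocks π < blocks σ
  Refines-strict⇒blocks-< cσ cπ σ⊑π σ≢π with m≤n⇒m<n∨m≡n (proj₁ (blocks-antitone cσ cπ σ⊑π))
  ... | inj₁ lt = lt
  ... | inj₂ e  = ⊥-elim (σ≢π (sym (proj₂ (blocks-antitone cσ cπ σ⊑π) e)))

  SameKernel : ℕ → (ℕ → ℕ) → (ℕ → ℕ) → Set
  SameKernel m ℓ ℓ′ = ∀ {j k} → j < m → k < m → (ℓ j ≡ ℓ k → ℓ′ j ≡ ℓ′ k) × (ℓ′ j ≡ ℓ′ k → ℓ j ≡ ℓ k)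

  SameKernel-sym : ∀ {m ℓ ℓ′} → SameKernel m ℓ ℓ′ → SameKernel m ℓ′ ℓ
  SameKernel-sym K j< k< = proj₂ (K j< k<) , proj₁ (K j< k<)

  SameKernel-respʳ : ∀ {m ℓ ℓ′ ℓ″} → SameKernel m ℓ ℓ′ → (∀ {j} → j < m → ℓ′ j ≡ ℓ″ j) → SameKernel m ℓ ℓ″
  SameKernel-respʳ K E j< k< =
    (λ e → trans (sym (E j<)) (trans (proj₁ (K j< k<) e) (E k<))) ,
    (λ e → proj₂ (K j< k<) (trans (E j<) (trans e (sym (E k<)))))

  SameKernel-extend : ∀ {m ℓ ℓ′} → SameKernel m ℓ ℓ′ →
    (∀ {j} → j < m → (ℓ j ≡ ℓ m → ℓ′ j ≡ ℓ′ m) × (ℓ′ j ≡ ℓ′ m → ℓ j ≡ ℓ m)) →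
    SameKernel (suc m) ℓ ℓ′
  SameKernel-extend K L j< k< with m≤n⇒m<n∨m≡n (≤-pred j<) | m≤n⇒m<n∨m≡n (≤-pred k<)
  ... | inj₁ j<m  | inj₁ k<m  = K j<m k<m
  ... | inj₁ j<m  | inj₂ refl = L j<m
  ... | inj₂ refl | inj₁ k<m  = (λ e → sym (proj₁ (L k<m) (sym e))) , (λ e → sym (proj₂ (L k<m) (sym e)))
  ... | inj₂ refl | inj₂ refl = (λ _ → refl) , (λ _ → refl)

  SameKernel-restrict : ∀ {m ℓ ℓ′} → SameKernel (suc m) ℓ ℓ′ → SameKernel m ℓ ℓ′
  SameKernel-restrict K j< k< = K (m<n⇒m<1+n j<) (m<n⇒m<1+n k<)

  canonicalise : ∀ m (ℓ : ℕ → ℕ) → ∃ λ p → Canonical m p × SameKernel m ℓ (lab p)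
  canonicalise zero    ℓ = [] , [] , λ ()
  canonicalise (suc m) ℓ with canonicalise m ℓ | anyUpTo? (λ j → ℓ j ≟ ℓ m) m
  ... | q , cq , K | yes (j , j< , ℓj≡ℓm) =
    q ∷ʳ lab q j , extend cq (<⇒≤ (lab<blocks-canonical cq j<)) ,
    SameKernel-extend K′ λ i< →
      (λ e → trans (lab-∷ʳ-< cq i<) (trans (proj₁ (K i< j<) (trans e (sym ℓj≡ℓm))) (sym (lab-∷ʳ-last cq)))) ,
      (λ e → trans (proj₂ (K i< j<) (trans (sym (lab-∷ʳ-< cq i<)) (trans e (lab-∷ʳ-last cq)))) ℓj≡ℓm)
    where K′ = SameKernel-respʳ K (λ i< → sym (lab-∷ʳ-< cq i<))
  ... | q , cq , K | no none =
    q ∷ʳ blocks q , extend cq ≤-refl ,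
    SameKernel-extend K′ λ {i} i< →
      (λ e → ⊥-elim (none (i , i< , e))) ,
      (λ e → ⊥-elim (<⇒≢ (lab<blocks-canonical cq i<)
                         (trans (sym (lab-∷ʳ-< cq i<)) (trans e (lab-∷ʳ-last cq)))))
    where K′ = SameKernel-respʳ K (λ i< → sym (lab-∷ʳ-< cq i<))

  swap : ℕ → ℕ → ℕ → ℕ
  swap a b x with x ≟ a | x ≟ b
  ... | yes _ | _     = b
  ... | no _  | yes _ = a
  ... | no _  | no _  = x

  swap-left : ∀ a b → swap a b a ≡ b
  swap-left a b with a ≟ a
  ... | yes _  = refl
  ... | no a≢a = ⊥-elim (a≢a refl)

  swap-right : ∀ a b → swap a b b ≡ a
  swap-right a b with b ≟ a | b ≟ b
  ... | yes b≡a | _      = b≡a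
  ... | no _    | yes _  = refl
  ... | no _    | no b≢b = ⊥-elim (b≢b refl)

  swap-other : ∀ a b {x} → x ≢ a → x ≢ b → swap a b x ≡ x
  swap-other a b {x} x≢a x≢b with x ≟ a | x ≟ b
  ... | yes x≡a | _       = ⊥-elim (x≢a x≡a)
  ... | no _    | yes x≡b = ⊥-elim (x≢b x≡b)
  ... | no _    | no _    = refl

  swap-involutive : ∀ a b x → swap a b (swap a b x) ≡ x
  swap-involutive a b x with x ≟ a | x ≟ b
  ... | yes refl | _        = swap-right x b
  ... | no _     | yes refl = swap-left a x
  ... | no x≢a   | no x≢b   = swap-other a b x≢a x≢b

  transposition : ℕ → ℕ → ℕ ↔ ℕ
  transposition a b = mk↔ₛ′ (swap a b) (swap a b) (swap-involutive a b) (swap-involutive a b)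

  kernel-permutation : ∀ {m ℓ ℓ′} → SameKernel m ℓ ℓ′ →
    ∃ λ (σ : ℕ ↔ ℕ) → ∀ {j} → j < m → Inverse.to σ (ℓ j) ≡ ℓ′ j
  kernel-permutation {zero}          K = ↔-id ℕ , λ ()
  kernel-permutation {suc m} {ℓ} {ℓ′} K with kernel-permutation (SameKernel-restrict K)
  ... | σ , σ-ok with Inverse.to σ (ℓ m) ≟ ℓ′ m
  ...   | yes hit = σ , λ j< → case m≤n⇒m<n∨m≡n (≤-pred j<) of λ where
                      (inj₁ j<m) → σ-ok j<m
                      (inj₂ refl) → hit
  ...   | no miss = transposition c d ↔-∘ σ , λ j< → case m≤n⇒m<n∨m≡n (≤-pred j<) of λ where
                      (inj₁ j<m) → trans (cong (swap c d) (σ-ok j<m)) (swap-other c d (≢c j<m) (≢d j<m))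
                      (inj₂ refl) → swap-left c d
    where
    c = Inverse.to σ (ℓ m)
    d = ℓ′ m
    ≢d : ∀ {j} → j < m → ℓ′ j ≢ d
    ≢d j< e = miss (trans (cong (Inverse.to σ) (sym (proj₂ (K (m<n⇒m<1+n j<) (n<1+n m)) e)))
                          (trans (σ-ok j<) e))
    ≢c : ∀ {j} → j < m → ℓ′ j ≢ c
    ≢c j< e = miss (trans (sym e) (proj₁ (K (m<n⇒m<1+n j<) (n<1+n m))
                                         (Injection.injective (↔⇒↣ σ) (trans (σ-ok j<) e))))

module ListSum {c ℓ} (R : CommutativeRing c ℓ) where

  open import Data.Bool using (true; false; if_then_else_)
  open import Data.Empty using (⊥-elim)
  open import Data.List using ([]; _∷_; map; foldr)
  open import Data.List.Relation.Unary.Any using (here; there)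
  import Data.List.Relation.Unary.All as All
  import Data.List.Relation.Unary.AllPairs as AllPairs
  open import Data.List.Relation.Unary.Unique.Propositional using (Unique)
  open import Function.Base using (_∘_)
  open import Relation.Binary.Definitions using (DecidableEquality)
  open import Relation.Nullary using (yes; no)
  open import Relation.Nullary.Decidable using (⌊_⌋)
  import Relation.Binary.PropositionalEquality as ≡

  open CommutativeRing R
  open import Algebra.Properties.Ring ring using (-0#≈0#; -‿+-comm)
  open import Algebra.Properties.CommutativeSemigroup +-commutativeSemigroup using (interchange)

  module _ {a} {A : Set a} where

    ∑ : List A → (A → Carrier) → Carrier
    ∑ xs F = foldr _+_ 0# (map F xs)

    ∑-cong : ∀ xs {F G} → (∀ {x} → x ∈ xs → F x ≈ G x) → ∑ xs F ≈ ∑ xs G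
    ∑-cong []       _ = refl
    ∑-cong (x ∷ xs) F≈G = +-cong (F≈G (here ≡.refl)) (∑-cong xs (F≈G ∘ there))

    ∑-zero : ∀ xs {F} → (∀ {x} → x ∈ xs → F x ≈ 0#) → ∑ xs F ≈ 0#
    ∑-zero []       _ = refl
    ∑-zero (x ∷ xs) F≈0 = trans (+-cong (F≈0 (here ≡.refl)) (∑-zero xs (F≈0 ∘ there))) (+-identityˡ 0#)

    ∑-distrib-+ : ∀ xs F G → ∑ xs (λ x → F x + G x) ≈ ∑ xs F + ∑ xs G
    ∑-distrib-+ []       F G = sym (+-identityˡ 0#)
    ∑-distrib-+ (x ∷ xs) F G = trans (+-congˡ (∑-distrib-+ xs F G)) (interchange _ _ _ _)

    *-distribˡ-∑ : ∀ xs y F → y * ∑ xs F ≈ ∑ xs (λ x → y * F x)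
    *-distribˡ-∑ []       y F = zeroʳ y
    *-distribˡ-∑ (x ∷ xs) y F = trans (distribˡ y _ _) (+-congˡ (*-distribˡ-∑ xs y F))

    -‿distrib-∑ : ∀ xs F → - ∑ xs F ≈ ∑ xs (λ x → - F x)
    -‿distrib-∑ []       F = -0#≈0#
    -‿distrib-∑ (x ∷ xs) F = trans (sym (-‿+-comm _ _)) (+-congˡ (-‿distrib-∑ xs F))

    ∑-if : ∀ xs b F → ∑ xs (λ x → if b then F x else 0#) ≈ (if b then ∑ xs F else 0#)
    ∑-if xs true  F = refl
    ∑-if xs false F = ∑-zero xs (λ _ → refl)

    ∑-δ : (_≟_ : DecidableEquality A) → ∀ {xs y} (F : A → Carrier) → Unique xs → y ∈ xs →
      ∑ xs (λ x → if ⌊ x ≟ y ⌋ then F x else 0#) ≈ F y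
    ∑-δ _≟_ {x ∷ xs} F (x∉xs AllPairs.∷ u) (here ≡.refl) with x ≟ x
    ... | no x≢x = ⊥-elim (x≢x ≡.refl)
    ... | yes _  = trans (+-congˡ (∑-zero xs miss)) (+-identityʳ _)
      where
      miss : ∀ {z} → z ∈ xs → (if ⌊ z ≟ x ⌋ then F z else 0#) ≈ 0#
      miss {z} z∈ with z ≟ x
      ... | yes z≡x = ⊥-elim (All.lookup x∉xs z∈ (≡.sym z≡x))
      ... | no _    = refl
    ∑-δ _≟_ {x ∷ xs} {y} F (x∉xs AllPairs.∷ u) (there y∈) with x ≟ y
    ... | yes x≡y = ⊥-elim (All.lookup x∉xs y∈ x≡y)
    ... | no _    = trans (+-identityˡ _) (∑-δ _≟_ F u y∈)

  ∑-comm : ∀ {a b} {A : Set a} {B : Set b} (xs : List A) (ys : List B) (F : A → B → Carrier) →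
    ∑ xs (λ x → ∑ ys (F x)) ≈ ∑ ys (λ y → ∑ xs (λ x → F x y))
  ∑-comm []       ys F = sym (∑-zero ys (λ _ → refl))
  ∑-comm (x ∷ xs) ys F =
    trans (+-congˡ (∑-comm xs ys F)) (sym (∑-distrib-+ ys (F x) (λ y → ∑ xs (λ x → F x y))))

module Mobius {c ℓ} (K : Field c ℓ) where

  open import Data.Nat using (zero; _<_; _∸_; _≟_; anyUpTo?)
  open import Data.Nat.Properties
  open import Data.Bool using (Bool; true; false; if_then_else_; not; _∧_)
  open import Data.Empty using (⊥-elim)
  open import Data.Product using (∃; _,_; proj₁; proj₂)
  open import Data.List.Properties using (≡-dec)
  open import Relation.Nullary using (¬_; Dec; yes; no; ¬?; _×-dec_)
  open import Relation.Nullary.Decidable using (⌊_⌋)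
  import Relation.Binary.PropositionalEquality as ≡
  open ≡ using (_≡_; _≢_)

  open Theory K
  open RestrictedGrowth
  open ListSum K.commutativeRing
  open K using (Carrier; _≈_; _+_; _*_; -_; _-_; 0#; 1#; refl; sym; trans; +-cong; +-congˡ; +-congʳ; *-congˡ; -‿cong)
  open import Algebra.Properties.Ring K.ring using (-‿distribʳ-*; -0#≈0#; //-rightDividesˡ; +-identityˡ-unique)
  open import Relation.Binary.Reasoning.Setoid K.setoid

  x-0≈x : ∀ x → x - 0# ≈ x
  x-0≈x x = trans (+-congˡ -0#≈0#) (K.+-identityʳ x)

  module _ (m : ℕ) where

    mobius′-stable₀ : ∀ g {σ ρ} → Canonical m σ → Canonical m ρ → blocks σ ∸ blocks ρ ≤ 0 →
      mobius′ 0 m σ ρ ≈ mobius′ g m σ ρ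
    mobius′-stable₀ zero    _ _ _ = refl
    mobius′-stable₀ (suc g) {σ} {ρ} cσ cρ d≤0 with eqP σ ρ in e | refines m σ ρ in r
    ... | true  | _     = refl
    ... | false | false = refl
    ... | false | true  = ⊥-elim (1+n≰n (≤-trans (m<n⇒0<n∸m σ<ρ) d≤0))
      where σ<ρ = Refines-strict⇒blocks-< cσ cρ (refines-sound m σ ρ r) (eqP-false e)

    -- The recursion depth only matters up to the length of the longest chain from σ to ρ.
    mobius′-stable : ∀ f g {σ ρ} → Canonical m σ → Canonical m ρ →
      blocks σ ∸ blocks ρ ≤ f → blocks σ ∸ blocks ρ ≤ g → mobius′ f m σ ρ ≈ mobius′ g m σ ρ
    mobius′-stable zero    g       cσ cρ df dg = mobius′-stable₀ g cσ cρ df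
    mobius′-stable (suc f) zero    cσ cρ df dg = sym (mobius′-stable₀ (suc f) cσ cρ dg)
    mobius′-stable (suc f) (suc g) {σ} {ρ} cσ cρ df dg with eqP σ ρ in e | refines m σ ρ in r
    ... | true  | _     = refl
    ... | false | false = refl
    ... | false | true  = -‿cong (∑-cong (Partitions m) λ ρ′∈ → term (∈Partitions⇒Canonical ρ′∈))
      where
      term : ∀ {ρ′} → Canonical m ρ′ →
        (if refines m σ ρ′ ∧ refines m ρ′ ρ ∧ not (eqP ρ′ ρ) then mobius′ f m σ ρ′ else 0#) ≈
        (if refines m σ ρ′ ∧ refines m ρ′ ρ ∧ not (eqP ρ′ ρ) then mobius′ g m σ ρ′ else 0#)
      term {ρ′} cρ′ with refines m σ ρ′ in a | refines m ρ′ ρ in b | eqP ρ′ ρ in c′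
      ... | false | _     | _     = refl
      ... | true  | false | _     = refl
      ... | true  | true  | true  = refl
      ... | true  | true  | false = mobius′-stable f g cσ cρ′ (shrink df) (shrink dg)
        where
        ρ′≺ρ = Refines-strict⇒blocks-< cρ′ cρ (refines-sound m ρ′ ρ b) (eqP-false c′)
        shrink : ∀ {x} → blocks σ ∸ blocks ρ ≤ suc x → blocks σ ∸ blocks ρ′ ≤ x
        shrink d = ≤-pred (≤-trans (∸-monoʳ-< ρ′≺ρ (proj₁ (blocks-antitone cσ cρ′ (refines-sound m σ ρ′ a)))) d)

  module Inversion (m′ : ℕ) (h : List ℕ → Carrier) where

    m : ℕ
    m = suc m′

    Parts : List (List ℕ)
    Parts = Partitions m

    _⊏ᵇ_ : List ℕ → List ℕ → Bool
    ρ ⊏ᵇ π = refines m ρ π ∧ not (eqP ρ π)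

    -- κ′ f is partCumulant with the Möbius recursion cut off at depth f, and κ is partCumulant itself.
    κ′ : ℕ → List ℕ → Carrier
    κ′ f π = ∑ Parts (λ σ → if refines m σ π then h σ * mobius′ f m σ π else 0#)

    κ : List ℕ → Carrier
    κ = κ′ m

    ∑-δ-eqP : ∀ (F : List ℕ → Carrier) {π} → Canonical m π →
      ∑ Parts (λ σ → if eqP σ π then F σ else 0#) ≈ F π
    ∑-δ-eqP F cπ = ∑-δ (≡-dec _≟_) F (Partitions-unique m) (Canonical⇒∈Partitions cπ)

    below : ℕ → List ℕ → List ℕ → List ℕ → Carrier
    below f π σ ρ = if ρ ⊏ᵇ π then (if refines m σ ρ then h σ * mobius′ f m σ ρ else 0#) else 0#

    below-vanishes : ∀ f {π σ} → (∀ {ρ} → Canonical m ρ → ρ ⊏ᵇ π ≡ true → ¬ Refines m σ ρ) →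
      ∑ Parts (below f π σ) ≈ 0#
    below-vanishes f {π} {σ} none = ∑-zero Parts λ ρ∈ → term (∈Partitions⇒Canonical ρ∈)
      where
      term : ∀ {ρ} → Canonical m ρ →
        (if ρ ⊏ᵇ π then (if refines m σ ρ then h σ * mobius′ f m σ ρ else 0#) else 0#) ≈ 0#
      term {ρ} cρ with ρ ⊏ᵇ π in ρ⊏π | refines m σ ρ in σ⊑ρ
      ... | false | _     = refl
      ... | true  | false = refl
      ... | true  | true  = ⊥-elim (none cρ ρ⊏π (refines-sound m σ ρ σ⊑ρ))

    ⊏ᵇ-sound : ∀ ρ π → ρ ⊏ᵇ π ≡ true → Refines m ρ π × ρ ≢ π
    ⊏ᵇ-sound ρ π lt with refines m ρ π in r | eqP ρ π in e
    ... | true | false = refines-sound m ρ π r , eqP-false e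

    κ′-suc-term : ∀ f {π σ} → Canonical m π → Canonical m σ →
      (if refines m σ π then h σ * mobius′ (suc f) m σ π else 0#) ≈
      (if eqP σ π then h σ else 0#) - ∑ Parts (below f π σ)
    κ′-suc-term f {π} {σ} cπ cσ with eqP σ π in e
    ... | true with eqP-sound e
    ...   | ≡.refl rewrite refines-complete m σ σ Refines-refl = begin
      h σ * 1#                          ≈⟨ K.*-identityʳ _ ⟩
      h σ                               ≈⟨ x-0≈x _ ⟨
      h σ - 0#                          ≈⟨ +-congˡ (-‿cong (below-vanishes f coarser)) ⟨
      h σ - ∑ Parts (below f σ σ)       ∎
      where
      coarser : ∀ {ρ} → Canonical m ρ → ρ ⊏ᵇ σ ≡ true → ¬ Refines m σ ρ
      coarser {ρ} cρ lt σ⊑ρ = proj₂ (⊏ᵇ-sound ρ σ lt) (Refines-antisym cρ cσ (proj₁ (⊏ᵇ-sound ρ σ lt)) σ⊑ρ)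
    κ′-suc-term f {π} {σ} cπ cσ | false with refines m σ π in r
    ... | false = begin
      0#                                ≈⟨ x-0≈x _ ⟨
      0# - 0#                           ≈⟨ +-congˡ (-‿cong (below-vanishes f unrelated)) ⟨
      0# - ∑ Parts (below f π σ)        ∎
      where
      unrelated : ∀ {ρ} → Canonical m ρ → ρ ⊏ᵇ π ≡ true → ¬ Refines m σ ρ
      unrelated {ρ} _ lt σ⊑ρ = refines-false m σ π r (Refines-trans σ⊑ρ (proj₁ (⊏ᵇ-sound ρ π lt)))
    ... | true = begin
      h σ * - ∑ Parts S                        ≈⟨ -‿distribʳ-* _ _ ⟨
      - (h σ * ∑ Parts S)                      ≈⟨ -‿cong (*-distribˡ-∑ Parts (h σ) S) ⟩
      - ∑ Parts (λ ρ → h σ * S ρ)              ≈⟨ -‿cong (∑-cong Parts (λ {ρ} _ → term ρ)) ⟩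
      - ∑ Parts (below f π σ)                  ≈⟨ K.+-identityˡ _ ⟨
      0# - ∑ Parts (below f π σ)               ∎
      where
      S : List ℕ → Carrier
      S ρ = if refines m σ ρ ∧ ρ ⊏ᵇ π then mobius′ f m σ ρ else 0#
      term : ∀ ρ → h σ * S ρ ≈ below f π σ ρ
      term ρ with refines m σ ρ | ρ ⊏ᵇ π
      ... | false | false = K.zeroʳ _
      ... | false | true  = K.zeroʳ _
      ... | true  | false = K.zeroʳ _
      ... | true  | true  = refl

    κ′-suc : ∀ f {π} → Canonical m π →
      κ′ (suc f) π ≈ h π - ∑ Parts (λ ρ → if ρ ⊏ᵇ π then κ′ f ρ else 0#)
    κ′-suc f {π} cπ = begin
      κ′ (suc f) π
        ≈⟨ ∑-cong Parts (λ σ∈ → κ′-suc-term f cπ (∈Partitions⇒Canonical σ∈)) ⟩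
      ∑ Parts (λ σ → (if eqP σ π then h σ else 0#) - ∑ Parts (below f π σ))
        ≈⟨ ∑-distrib-+ Parts _ _ ⟩
      ∑ Parts (λ σ → if eqP σ π then h σ else 0#) + ∑ Parts (λ σ → - ∑ Parts (below f π σ))
        ≈⟨ +-cong (∑-δ-eqP h cπ) (sym (-‿distrib-∑ Parts _)) ⟩
      h π - ∑ Parts (λ σ → ∑ Parts (below f π σ))
        ≈⟨ +-congˡ (-‿cong (∑-comm Parts Parts (below f π))) ⟩
      h π - ∑ Parts (λ ρ → ∑ Parts (λ σ → below f π σ ρ))
        ≈⟨ +-congˡ (-‿cong (∑-cong Parts (λ {ρ} _ → ∑-if Parts (ρ ⊏ᵇ π) _))) ⟩
      h π - ∑ Parts (λ ρ → if ρ ⊏ᵇ π then κ′ f ρ else 0#) ∎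

    κ′-stable : ∀ f g {π} → Canonical m π → m ∸ blocks π ≤ f → m ∸ blocks π ≤ g → κ′ f π ≈ κ′ g π
    κ′-stable f g {π} cπ df dg = ∑-cong Parts λ σ∈ → term (∈Partitions⇒Canonical σ∈)
      where
      term : ∀ {σ} → Canonical m σ →
        (if refines m σ π then h σ * mobius′ f m σ π else 0#) ≈
        (if refines m σ π then h σ * mobius′ g m σ π else 0#)
      term {σ} cσ with refines m σ π
      ... | false = refl
      ... | true  = *-congˡ (mobius′-stable m f g cσ cπ (≤-trans d df) (≤-trans d dg))
        where d = ∸-monoˡ-≤ (blocks π) (canonical-blocks≤ cσ)

    ∑-κ-refining : ∀ {π} → Canonical m π → ∑ Parts (λ ρ → if refines m ρ π then κ ρ else 0#) ≈ h π
    ∑-κ-refining {π} cπ = begin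
      ∑ Parts (λ ρ → if refines m ρ π then κ ρ else 0#)
        ≈⟨ ∑-cong Parts (λ {ρ} _ → split ρ) ⟩
      ∑ Parts (λ ρ → (if eqP ρ π then κ ρ else 0#) + (if ρ ⊏ᵇ π then κ ρ else 0#))
        ≈⟨ ∑-distrib-+ Parts _ _ ⟩
      ∑ Parts (λ ρ → if eqP ρ π then κ ρ else 0#) + strictly-below
        ≈⟨ +-congʳ (∑-δ-eqP κ cπ) ⟩
      κ π + strictly-below
        ≈⟨ +-congʳ (κ′-suc m′ cπ) ⟩
      (h π - ∑ Parts (λ ρ → if ρ ⊏ᵇ π then κ′ m′ ρ else 0#)) + strictly-below
        ≈⟨ +-congʳ (+-congˡ (-‿cong (∑-cong Parts λ ρ∈ → deepen (∈Partitions⇒Canonical ρ∈)))) ⟩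
      (h π - strictly-below) + strictly-below
        ≈⟨ //-rightDividesˡ _ _ ⟩
      h π ∎
      where
      strictly-below = ∑ Parts (λ ρ → if ρ ⊏ᵇ π then κ ρ else 0#)
      split : ∀ ρ → (if refines m ρ π then κ ρ else 0#) ≈
                    ((if eqP ρ π then κ ρ else 0#) + (if ρ ⊏ᵇ π then κ ρ else 0#))
      split ρ with refines m ρ π in r | eqP ρ π in e
      ... | false | false = sym (K.+-identityˡ 0#)
      ... | false | true  = ⊥-elim (refines-false m ρ π r (≡.subst (Refines m ρ) (eqP-sound e) Refines-refl))
      ... | true  | false = sym (K.+-identityˡ _)
      ... | true  | true  = sym (K.+-identityʳ _)
      deepen : ∀ {ρ} → Canonical m ρ → (if ρ ⊏ᵇ π then κ′ m′ ρ else 0#) ≈ (if ρ ⊏ᵇ π then κ ρ else 0#)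
      deepen {ρ} cρ with ρ ⊏ᵇ π in lt
      ... | false = refl
      ... | true  = κ′-stable m′ m cρ (∸-monoʳ-≤ m (≤-trans (s≤s z≤n) ρ≺π)) (m∸n≤m m (blocks ρ))
        where ρ≺π = Refines-strict⇒blocks-< cρ cπ (proj₁ (⊏ᵇ-sound ρ π lt)) (proj₂ (⊏ᵇ-sound ρ π lt))

  module Vanishing (m′ i : ℕ) (i<m : i < suc m′) (H : (ℕ → ℕ) → Carrier)
      (H-local  : ∀ {ℓ ℓ′} → (∀ {j} → j < suc m′ → j ≢ i → ℓ j ≡ ℓ′ j) → H ℓ ≈ H ℓ′)
      (H-kernel : ∀ {ℓ ℓ′} → SameKernel (suc m′) ℓ ℓ′ → H ℓ ≈ H ℓ′) where

    open Inversion m′ (λ σ → H (lab σ))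

    Shares : List ℕ → Set
    Shares ρ = ∃ λ j → j < m × j ≢ i × lab ρ j ≡ lab ρ i

    shares? : ∀ ρ → Dec (Shares ρ)
    shares? ρ = anyUpTo? (λ j → ¬? (j ≟ i) ×-dec (lab ρ j ≟ lab ρ i)) m

    module Isolate {π} (cπ : Canonical m π) where

      relabel : ℕ → ℕ
      relabel j with j ≟ i
      ... | yes _ = blocks π
      ... | no _  = lab π j

      relabel-i : relabel i ≡ blocks π
      relabel-i with i ≟ i
      ... | yes _  = ≡.refl
      ... | no i≢i = ⊥-elim (i≢i ≡.refl)

      relabel-≢ : ∀ {j} → j ≢ i → relabel j ≡ lab π j
      relabel-≢ {j} j≢i with j ≟ i
      ... | yes j≡i = ⊥-elim (j≢i j≡i)
      ... | no _    = ≡.refl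

      separated : ∀ {k} → k < m → k ≢ i → relabel i ≢ relabel k
      separated k< k≢i e =
        <⇒≢ (lab<blocks-canonical cπ k<) (≡.sym (≡.trans (≡.sym relabel-i) (≡.trans e (relabel-≢ k≢i))))

      π° : List ℕ
      π° = proj₁ (canonicalise m relabel)

      cπ° : Canonical m π°
      cπ° = proj₁ (proj₂ (canonicalise m relabel))

      K° : SameKernel m relabel (lab π°)
      K° = proj₂ (proj₂ (canonicalise m relabel))

      H-π° : H (lab π°) ≈ H (lab π)
      H-π° = trans (H-kernel (SameKernel-sym K°)) (H-local (λ _ → relabel-≢))

      Refines-π° : ∀ {ρ} → Refines m ρ π° → Refines m ρ π × ¬ Shares ρ
      Refines-π° {ρ} ρ⊑π° = refining coarser , λ (j , j< , j≢i , e) → separated j< j≢i (≡.sym (via j< i<m e))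
        where
        via : ∀ {j k} → j < m → k < m → lab ρ j ≡ lab ρ k → relabel j ≡ relabel k
        via j< k< e = proj₂ (K° j< k<) (sameBlock ρ⊑π° j< k< e)
        coarser : ∀ {j k} → j < m → k < m → lab ρ j ≡ lab ρ k → lab π j ≡ lab π k
        coarser {j} {k} j< k< e with j ≟ i | k ≟ i
        ... | yes ≡.refl | yes ≡.refl = ≡.refl
        ... | yes ≡.refl | no k≢i     = ⊥-elim (separated k< k≢i (via j< k< e))
        ... | no j≢i     | yes ≡.refl = ⊥-elim (separated j< j≢i (≡.sym (via j< k< e)))
        ... | no j≢i     | no k≢i     = ≡.trans (≡.sym (relabel-≢ j≢i)) (≡.trans (via j< k< e) (relabel-≢ k≢i))

      Refines-π°⁺ : ∀ {ρ} → Refines m ρ π → ¬ Shares ρ → Refines m ρ π°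
      Refines-π°⁺ {ρ} ρ⊑π alone = refining λ {j} {k} j< k< e → proj₁ (K° j< k<) (via (j ≟ i) (k ≟ i) j< k< e)
        where
        via : ∀ {j k} → Dec (j ≡ i) → Dec (k ≡ i) → j < m → k < m → lab ρ j ≡ lab ρ k → relabel j ≡ relabel k
        via (yes ≡.refl) (yes ≡.refl) _  _  _ = ≡.refl
        via (yes ≡.refl) (no k≢i)     _  k< e = ⊥-elim (alone (_ , k< , k≢i , ≡.sym e))
        via (no j≢i)     (yes ≡.refl) j< _  e = ⊥-elim (alone (_ , j< , j≢i , e))
        via (no j≢i)     (no k≢i)     j< k< e =
          ≡.trans (relabel-≢ j≢i) (≡.trans (sameBlock ρ⊑π j< k< e) (≡.sym (relabel-≢ k≢i)))

      refines-π° : ∀ ρ → refines m ρ π° ≡ refines m ρ π ∧ not ⌊ shares? ρ ⌋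
      refines-π° ρ with refines m ρ π° in a | refines m ρ π in b | shares? ρ
      ... | true  | true  | yes s  = ⊥-elim (proj₂ (Refines-π° (refines-sound m ρ π° a)) s)
      ... | true  | true  | no _   = ≡.refl
      ... | true  | false | _      = ⊥-elim (refines-false m ρ π b (proj₁ (Refines-π° (refines-sound m ρ π° a))))
      ... | false | true  | yes _  = ≡.refl
      ... | false | true  | no ¬s  = ⊥-elim (refines-false m ρ π° a (Refines-π°⁺ (refines-sound m ρ π b) ¬s))
      ... | false | false | _      = ≡.refl

    -- The refinements of π in which i is not a singleton contribute h π − h π° = 0 in total, and all
    -- of them except π itself vanish by induction.
    κ-vanishes-step : ∀ {π} → Canonical m π → Shares π →
      (∀ {ρ} → Canonical m ρ → ρ ⊏ᵇ π ≡ true → Shares ρ → κ ρ ≈ 0#) → κ π ≈ 0#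
    κ-vanishes-step {π} cπ sπ IH = begin
      κ π                                          ≈⟨ ∑-δ-eqP κ cπ ⟨
      ∑ Parts (λ ρ → if eqP ρ π then κ ρ else 0#)  ≈⟨ ∑-cong Parts (λ ρ∈ → only-π (∈Partitions⇒Canonical ρ∈)) ⟨
      ∑ Parts A                                    ≈⟨ +-identityˡ-unique (∑ Parts A) (H (lab π)) ∑A+Hπ≈Hπ ⟩
      0#                                           ∎
      where
      open Isolate cπ
      A B : List ℕ → Carrier
      A ρ = if refines m ρ π ∧ ⌊ shares? ρ ⌋ then κ ρ else 0#
      B ρ = if refines m ρ π° then κ ρ else 0#

      split : ∀ ρ → A ρ + B ρ ≈ (if refines m ρ π then κ ρ else 0#)
      split ρ rewrite refines-π° ρ with refines m ρ π | ⌊ shares? ρ ⌋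
      ... | false | _     = K.+-identityˡ 0#
      ... | true  | true  = K.+-identityʳ _
      ... | true  | false = K.+-identityˡ _

      ∑A+Hπ≈Hπ : ∑ Parts A + H (lab π) ≈ H (lab π)
      ∑A+Hπ≈Hπ = begin
        ∑ Parts A + H (lab π)                              ≈⟨ +-congˡ (trans (∑-κ-refining cπ°) H-π°) ⟨
        ∑ Parts A + ∑ Parts B                              ≈⟨ ∑-distrib-+ Parts A B ⟨
        ∑ Parts (λ ρ → A ρ + B ρ)                          ≈⟨ ∑-cong Parts (λ {ρ} _ → split ρ) ⟩
        ∑ Parts (λ ρ → if refines m ρ π then κ ρ else 0#)  ≈⟨ ∑-κ-refining cπ ⟩
        H (lab π)                                          ∎

      only-π : ∀ {ρ} → Canonical m ρ → A ρ ≈ (if eqP ρ π then κ ρ else 0#)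
      only-π {ρ} cρ with eqP ρ π in e
      ... | true with eqP-sound e
      ...   | ≡.refl rewrite refines-complete m ρ ρ Refines-refl with shares? ρ
      ...     | yes _ = refl
      ...     | no ¬s = ⊥-elim (¬s sπ)
      only-π {ρ} cρ | false with refines m ρ π in r | shares? ρ
      ... | false | _     = refl
      ... | true  | no _  = refl
      ... | true  | yes s = IH cρ (≡.cong₂ _∧_ r (≡.cong not e)) s

    κ-vanishes : ∀ {π} → π ∈ Partitions m → Shares π → κ π ≈ 0#
    κ-vanishes {π} π∈ = by-fuel (suc m) (∈Partitions⇒Canonical π∈) (s≤s (m∸n≤m m (blocks π)))
      where
      by-fuel : ∀ d {π} → Canonical m π → m ∸ blocks π < d → Shares π → κ π ≈ 0#
      by-fuel (suc d) {π} cπ fuel sπ = κ-vanishes-step cπ sπ λ {ρ} cρ lt →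
        by-fuel d cρ (≤-trans (∸-monoʳ-< (Refines-strict⇒blocks-< cρ cπ (proj₁ (⊏ᵇ-sound ρ π lt))
                                                                    (proj₂ (⊏ᵇ-sound ρ π lt)))
                                          (canonical-blocks≤ cρ))
                              (≤-pred fuel))

module FinSums {a ℓa} (R : Ring a ℓa) where

  open import Data.Nat using (zero)
  open import Data.Fin using (zero; suc)
  open Ring R hiding (zero)
  open RingOps R

  sumFin-cong : ∀ {n} {f g : Fin n → Carrier} → (∀ j → f j ≈ g j) → sumFin f ≈ sumFin g
  sumFin-cong {zero}  _   = refl
  sumFin-cong {suc n} f≈g = +-cong (f≈g zero) (sumFin-cong (λ j → f≈g (suc j)))

  prodFin-cong : ∀ {n} {f g : Fin n → Carrier} → (∀ j → f j ≈ g j) → prodFin f ≈ prodFin g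
  prodFin-cong {zero}  _   = refl
  prodFin-cong {suc n} f≈g = *-cong (f≈g zero) (prodFin-cong (λ j → f≈g (suc j)))

  prodFin-zero : ∀ {n} (f : Fin n → Carrier) i → f i ≈ 0# → prodFin f ≈ 0#
  prodFin-zero f zero    fi≈0 = trans (*-congʳ fi≈0) (zeroˡ _)
  prodFin-zero f (suc i) fi≈0 = trans (*-congˡ (prodFin-zero (λ j → f (suc j)) i fi≈0)) (zeroʳ _)

  *-distribˡ-sumFin : ∀ {n} x (f : Fin n → Carrier) → x * sumFin f ≈ sumFin (λ j → x * f j)
  *-distribˡ-sumFin {zero}  x f = zeroʳ x
  *-distribˡ-sumFin {suc n} x f = trans (distribˡ x _ _) (+-congˡ (*-distribˡ-sumFin x (λ j → f (suc j))))

  sumMulti-cong : ∀ m n {F G : (Fin m → Fin n) → Carrier} → (∀ g → F g ≈ G g) → sumMulti m n F ≈ sumMulti m n G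
  sumMulti-cong zero    n F≈G = F≈G _
  sumMulti-cong (suc m) n {F} {G} F≈G = sumFin-cong {n} (λ j → sumMulti-cong m n (λ g → F≈G _))

  *-distribˡ-sumMulti : ∀ m n x (F : (Fin m → Fin n) → Carrier) →
    x * sumMulti m n F ≈ sumMulti m n (λ g → x * F g)
  *-distribˡ-sumMulti zero    n x F = refl
  *-distribˡ-sumMulti (suc m) n x F =
    trans (*-distribˡ-sumFin {n} x _) (sumFin-cong {n} (λ j → *-distribˡ-sumMulti m n x _))

module AlgProperties {c ℓ a ℓa} (K : Field c ℓ) (A : Theory.Alg K a ℓa) where

  open Theory K
  open import Data.Nat using (zero)
  open import Data.Fin using (zero; suc)
  open Alg A
  open import Algebra.Properties.Ring ring using (x+x≈x⇒x≈0)

  ·-zeroˡ : ∀ x → (K.0# · x) ≈ 0#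
  ·-zeroˡ x = x+x≈x⇒x≈0 _ (trans (sym (·-distribʳ K.0# K.0# x)) (·-cong (K.+-identityʳ K.0#) refl))

  ·-zeroʳ : ∀ k → (k · 0#) ≈ 0#
  ·-zeroʳ k = x+x≈x⇒x≈0 _ (trans (sym (·-distribˡ k 0# 0#)) (·-cong K.refl (+-identityʳ 0#)))

  sumFin-·ʳ : ∀ {n} (f : Fin n → K.Carrier) y → sumFin (λ j → f j · y) ≈ (sumK f · y)
  sumFin-·ʳ {zero}  f y = sym (·-zeroˡ y)
  sumFin-·ʳ {suc n} f y =
    trans (+-congˡ (sumFin-·ʳ (λ j → f (suc j)) y)) (sym (·-distribʳ _ _ _))

module Multilinearity {c ℓ a ℓa} (K : Field c ℓ) (A : Theory.Alg K a ℓa) where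

  open import Level using (Lift; lift; lower; _⊔_)
  open import Data.Nat using (zero)
  open import Data.Fin using (zero; suc)
  open import Data.Bool using (Bool; true; false; if_then_else_)
  open import Data.List using ([]; _∷_)
  open import Data.Product using (_,_)
  open import Data.Vec.Functional as V using (Vector; tail; updateAt)
  open Theory K
  private module A = Alg A
  open ListSum K.commutativeRing using (∑)
  open FinSums K.ring
  open AlgProperties K A using (·-zeroˡ)
  open K using (Carrier; _≈_; _+_; _*_; 0#; 1#; refl; sym; trans; +-cong; +-congˡ; *-congˡ)
  open import Relation.Binary.Reasoning.Setoid K.setoid

  Functional : ℕ → Set (a ⊔ c)
  Functional m = Vector A.Carrier m → Carrier

  Congruent : ∀ {m} → Functional m → Set (a ⊔ ℓa ⊔ ℓ)
  Congruent L = ∀ {v w} → (∀ i → v i A.≈ w i) → L v ≈ L w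

  Multilinear : ∀ m → Functional m → Set (a ⊔ ℓa ⊔ c ⊔ ℓ)
  Multilinear zero    L = Lift c (Congruent L)
  Multilinear (suc m) L = Congruent L
                        × (∀ x y w → L ((x A.+ y) V.∷ w) ≈ L (x V.∷ w) + L (y V.∷ w))
                        × (∀ k x w → L ((k A.· x) V.∷ w) ≈ k * L (x V.∷ w))
                        × (∀ x → Multilinear m (λ w → L (x V.∷ w)))

  ∷-η : ∀ {m} (v : Vector A.Carrier (suc m)) i → v i A.≈ (v zero V.∷ tail v) i
  ∷-η v zero    = A.refl
  ∷-η v (suc i) = A.refl

  Multilinear-resp : ∀ {m L L′} → (∀ v → L v ≈ L′ v) → Multilinear m L → Multilinear m L′
  Multilinear-resp {zero}  L≈L′ ml = lift λ v≈w → trans (sym (L≈L′ _)) (trans (lower ml v≈w) (L≈L′ _))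
  Multilinear-resp {suc m} L≈L′ (cg , add , hom , tl) =
    (λ v≈w → trans (sym (L≈L′ _)) (trans (cg v≈w) (L≈L′ _))) ,
    (λ x y w → trans (sym (L≈L′ _)) (trans (add x y w) (+-cong (L≈L′ _) (L≈L′ _)))) ,
    (λ k x w → trans (sym (L≈L′ _)) (trans (hom k x w) (*-congˡ (L≈L′ _)))) ,
    (λ x → Multilinear-resp (λ w → L≈L′ (x V.∷ w)) (tl x))

  Multilinear-zero : ∀ {m} → Multilinear m (λ _ → 0#)
  Multilinear-zero {zero}  = lift λ _ → refl
  Multilinear-zero {suc m} = (λ _ → refl) , (λ _ _ _ → sym (K.+-identityˡ 0#)) ,
                             (λ k _ _ → sym (K.zeroʳ k)) , (λ _ → Multilinear-zero)

  Multilinear-+ : ∀ {m L L′} → Multilinear m L → Multilinear m L′ → Multilinear m (λ v → L v + L′ v)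
  Multilinear-+ {zero}  ml ml′ = lift λ v≈w → +-cong (lower ml v≈w) (lower ml′ v≈w)
  Multilinear-+ {suc m} (cg , add , hom , tl) (cg′ , add′ , hom′ , tl′) =
    (λ v≈w → +-cong (cg v≈w) (cg′ v≈w)) ,
    (λ x y w → trans (+-cong (add x y w) (add′ x y w)) (interchange _ _ _ _)) ,
    (λ k x w → trans (+-cong (hom k x w) (hom′ k x w)) (sym (K.distribˡ k _ _))) ,
    (λ x → Multilinear-+ (tl x) (tl′ x))
    where open import Algebra.Properties.CommutativeSemigroup K.+-commutativeSemigroup using (interchange)

  Multilinear-*ˡ : ∀ {m L} d → Multilinear m L → Multilinear m (λ v → d * L v)
  Multilinear-*ˡ {zero}  d ml = lift λ v≈w → *-congˡ (lower ml v≈w)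
  Multilinear-*ˡ {suc m} d (cg , add , hom , tl) =
    (λ v≈w → *-congˡ (cg v≈w)) ,
    (λ x y w → trans (*-congˡ (add x y w)) (K.distribˡ d _ _)) ,
    (λ k x w → trans (*-congˡ (hom k x w)) (x∙yz≈y∙xz d k _)) ,
    (λ x → Multilinear-*ˡ d (tl x))
    where open import Algebra.Properties.CommutativeSemigroup K.*-commutativeSemigroup using (x∙yz≈y∙xz)

  Multilinear-*ʳ : ∀ {m L} d → Multilinear m L → Multilinear m (λ v → L v * d)
  Multilinear-*ʳ d ml = Multilinear-resp (λ _ → K.*-comm d _) (Multilinear-*ˡ d ml)

  Multilinear-if : ∀ {m L} (b : Bool) → Multilinear m L → Multilinear m (λ v → if b then L v else 0#)
  Multilinear-if true  ml = ml
  Multilinear-if false ml = Multilinear-zero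

  Multilinear-∑ : ∀ {m} {b} {B : Set b} (xs : List B) {F : B → Functional m} →
    (∀ x → Multilinear m (F x)) → Multilinear m (λ v → ∑ xs (λ x → F x v))
  Multilinear-∑ []       ml = Multilinear-zero
  Multilinear-∑ (x ∷ xs) ml = Multilinear-+ (ml x) (Multilinear-∑ xs ml)

  Multilinear-sumFin-head : ∀ {m L} → Multilinear (suc m) L → ∀ {n} (f : Fin n → A.Carrier) w →
    L (A.sumFin f V.∷ w) ≈ sumK (λ j → L (f j V.∷ w))
  Multilinear-sumFin-head {L = L} (cg , add , hom , tl) {zero} f w = begin
    L (A.0# V.∷ w)               ≈⟨ cg (λ { zero → A.sym (·-zeroˡ A.0#) ; (suc i) → A.refl }) ⟩
    L ((K.0# A.· A.0#) V.∷ w)    ≈⟨ hom K.0# A.0# w ⟩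
    K.0# * L (A.0# V.∷ w)        ≈⟨ K.zeroˡ _ ⟩
    0#                           ∎
  Multilinear-sumFin-head ml@(cg , add , hom , tl) {suc n} f w =
    trans (add _ _ w) (+-congˡ (Multilinear-sumFin-head ml (λ j → f (suc j)) w))

  multilinear-expand : ∀ m {n} {L} → Multilinear m L → (α : Fin m → Fin n → Carrier) (X : Fin n → A.Carrier) →
    L (λ i → A.sumFin (λ j → α i j A.· X j))
      ≈ sumMultiK m n (λ j → prodK (λ i → α i (j i)) * L (λ i → X (j i)))
  multilinear-expand zero        ml α X = trans (lower ml (λ ())) (sym (K.*-identityˡ _))
  multilinear-expand (suc m) {n} {L} ml@(cg , add , hom , tl) α X = begin
    L S
      ≈⟨ cg (∷-η S) ⟩
    L (S zero V.∷ tail S)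
      ≈⟨ Multilinear-sumFin-head ml {n} _ _ ⟩
    sumK (λ j → L ((α zero j A.· X j) V.∷ tail S))
      ≈⟨ sumFin-cong {n} (λ j → hom _ _ _) ⟩
    sumK (λ j → α zero j * L (X j V.∷ tail S))
      ≈⟨ sumFin-cong {n} (λ j → *-congˡ (multilinear-expand m (tl (X j)) (λ i → α (suc i)) X)) ⟩
    sumK (λ j → α zero j * sumMultiK m n (λ g → prodK (λ i → α (suc i) (g i)) * L (X j V.∷ (λ i → X (g i)))))
      ≈⟨ sumFin-cong {n} (λ j → trans (*-distribˡ-sumMulti m n _ _)
                                  (sumMulti-cong m n (λ g → trans (sym (K.*-assoc _ _ _))
                                                                  (*-congˡ (cg (λ { zero → A.refl ; (suc i) → A.refl })))))) ⟩
    sumMultiK (suc m) n (λ j → prodK (λ i → α i (j i)) * L (λ i → X (j i))) ∎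
    where
    S : Fin (suc m) → A.Carrier
    S i = A.sumFin (λ j → α i j A.· X j)

  AnnihilatesUnit : ∀ m → Functional m → Set (a ⊔ ℓ)
  AnnihilatesUnit m L = ∀ i v → L (updateAt v i (λ _ → A.1#)) ≈ 0#

  drop-constants : ∀ m {L} → Multilinear m L → AnnihilatesUnit m L →
    ∀ (S : Fin m → A.Carrier) (β : Fin m → Carrier) → L (λ i → S i A.+ (β i A.· A.1#)) ≈ L S
  drop-constants zero          ml _   S β = lower ml (λ ())
  drop-constants (suc m) {L} ml@(cg , add , hom , tl) ann S β = begin
    L (λ i → S i A.+ (β i A.· A.1#))                ≈⟨ cg (∷-η _) ⟩
    L ((S zero A.+ (β zero A.· A.1#)) V.∷ T)        ≈⟨ add _ _ _ ⟩
    L (S zero V.∷ T) + L ((β zero A.· A.1#) V.∷ T)  ≈⟨ +-congˡ (hom _ _ _) ⟩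
    L (S zero V.∷ T) + β zero * L (A.1# V.∷ T)      ≈⟨ +-congˡ (*-congˡ (trans (cg unit-head) (ann zero (A.1# V.∷ T)))) ⟩
    L (S zero V.∷ T) + β zero * 0#                  ≈⟨ +-congˡ (K.zeroʳ _) ⟩
    L (S zero V.∷ T) + 0#                           ≈⟨ K.+-identityʳ _ ⟩
    L (S zero V.∷ T)                                ≈⟨ drop-constants m (tl (S zero)) ann-tail (tail S) (tail β) ⟩
    L (S zero V.∷ tail S)                           ≈⟨ cg (∷-η S) ⟨
    L S                                             ∎
    where
    T : Fin m → A.Carrier
    T i = S (suc i) A.+ (β (suc i) A.· A.1#)
    unit-head : ∀ i → (A.1# V.∷ T) i A.≈ updateAt (A.1# V.∷ T) zero (λ _ → A.1#) i
    unit-head zero    = A.refl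
    unit-head (suc i) = A.refl
    ann-tail : AnnihilatesUnit m (λ w → L (S zero V.∷ w))
    ann-tail i w = trans (cg unit-tail) (ann (suc i) (S zero V.∷ w))
      where
      unit-tail : ∀ j → (S zero V.∷ updateAt w i (λ _ → A.1#)) j A.≈ updateAt (S zero V.∷ w) (suc i) (λ _ → A.1#) j
      unit-tail zero    = A.refl
      unit-tail (suc j) = A.refl

  affine-expand : ∀ m {n} {L} → Multilinear m L → AnnihilatesUnit m L →
    (α : Fin m → Fin n → Carrier) (X : Fin n → A.Carrier) (β : Fin m → Carrier) →
    L (λ i → A.sumFin (λ j → α i j A.· X j) A.+ (β i A.· A.1#))
      ≈ sumMultiK m n (λ j → prodK (λ i → α i (j i)) * L (λ i → X (j i)))
  affine-expand m ml ann α X β =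
    trans (drop-constants m ml ann _ β) (multilinear-expand m ml α X)

module RootsOfUnity {c ℓ} (K : Field c ℓ) where

  open import Data.Nat using (zero)
  open import Data.Fin using (toℕ)
  open import Data.Product using (_,_; proj₁; proj₂)
  open import Relation.Nullary using (¬_)
  open Theory K
  open K using (Carrier; _≈_; _+_; _*_; _-_; 0#; 1#; sym; trans; +-cong; +-congˡ; +-congʳ; *-congˡ; *-congʳ)
  open FinSums K.ring using (*-distribˡ-sumFin)
  open import Algebra.Properties.Ring K.ring using ([y-z]x≈yx-zx; +-cancelˡ; x≈y⇒x∙y⁻¹≈ε; x∙y⁻¹≈ε⇒x≈y)
  open import Relation.Binary.Reasoning.Setoid K.setoid

  no-zero-divisors : ∀ {x y} → ¬ (x ≈ 0#) → x * y ≈ 0# → y ≈ 0#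
  no-zero-divisors {x} {y} x≉0 xy≈0 = begin
    y             ≈⟨ K.*-identityˡ y ⟨
    1# * y        ≈⟨ *-congʳ (trans (K.*-comm _ _) x*x⁻¹≈1) ⟨
    (x⁻¹ * x) * y ≈⟨ K.*-assoc _ _ _ ⟩
    x⁻¹ * (x * y) ≈⟨ *-congˡ xy≈0 ⟩
    x⁻¹ * 0#      ≈⟨ K.zeroʳ _ ⟩
    0#            ∎
    where
    x⁻¹ = proj₁ (K.inverse x x≉0)
    x*x⁻¹≈1 = proj₂ (K.inverse x x≉0)

  module _ (ω : Carrier) where

    powerSum : ℕ → Carrier
    powerSum n = sumK {n} (λ k → powK ω (suc (toℕ k)))

    powerSum-suc : ∀ n → powerSum (suc n) ≈ ω + ω * powerSum n
    powerSum-suc n = +-cong (K.*-identityʳ ω) (sym (*-distribˡ-sumFin {n} ω _))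

    powerSum-snoc : ∀ n → powerSum (suc n) ≈ powerSum n + powK ω (suc n)
    powerSum-snoc zero    = K.+-comm _ _
    powerSum-snoc (suc n) = begin
      powerSum (suc (suc n))                          ≈⟨ powerSum-suc (suc n) ⟩
      ω + ω * powerSum (suc n)                        ≈⟨ +-congˡ (*-congˡ (powerSum-snoc n)) ⟩
      ω + ω * (powerSum n + powK ω (suc n))           ≈⟨ +-congˡ (K.distribˡ ω _ _) ⟩
      ω + (ω * powerSum n + powK ω (suc (suc n)))     ≈⟨ K.+-assoc _ _ _ ⟨
      (ω + ω * powerSum n) + powK ω (suc (suc n))     ≈⟨ +-congʳ (powerSum-suc n) ⟨
      powerSum (suc n) + powK ω (suc (suc n))         ∎

    -- ω · S = S for S = ω + ω² + ⋯ + ωᵐ when ωᵐ = 1, and ω ≠ 1 then forces S = 0.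
    powerSum-vanishes : ∀ m → PrimitiveRoot (suc (suc m)) ω → powerSum (suc (suc m)) ≈ 0#
    powerSum-vanishes m (ωᴹ≈1 , ωᵏ≉1) = no-zero-divisors ω-1≉0 (begin
      (ω - 1#) * S    ≈⟨ [y-z]x≈yx-zx S ω 1# ⟩
      ω * S - 1# * S  ≈⟨ x≈y⇒x∙y⁻¹≈ε (trans ωS≈S (sym (K.*-identityˡ S))) ⟩
      0#              ∎)
      where
      M = suc (suc m)
      S = powerSum M
      ωS≈S : ω * S ≈ S
      ωS≈S = +-cancelˡ ω _ _ (begin
        ω + ω * S          ≈⟨ powerSum-suc M ⟨
        powerSum (suc M)   ≈⟨ powerSum-snoc M ⟩
        S + ω * powK ω M   ≈⟨ +-congˡ (trans (*-congˡ ωᴹ≈1) (K.*-identityʳ ω)) ⟩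
        S + ω              ≈⟨ K.+-comm _ _ ⟩
        ω + S              ∎)
      ω-1≉0 : ¬ (ω - 1# ≈ 0#)
      ω-1≉0 e = ωᵏ≉1 1 (s≤s z≤n) (s≤s (s≤s z≤n)) (trans (K.*-identityʳ ω) (x∙y⁻¹≈ε⇒x≈y ω 1# e))

module ProductFunctionals {c ℓ a ℓa u ℓu} (K : Field c ℓ) (A : Theory.Alg K a ℓa) (U : Theory.NCPS K u ℓu) where

  open import Level using (_⊔_; lift)
  open import Data.Nat using (zero)
  open import Data.Fin using (zero; suc)
  open import Data.Product using (_,_)
  open import Data.Vec.Functional as V using (updateAt)
  open import Data.Vec.Functional.Properties using (updateAt-updates)
  import Relation.Binary.PropositionalEquality as ≡
  open Theory K
  private
    module A = Alg A
    module U = NCPS U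
  open Multilinearity K A
  open FinSums U.ring using (prodFin-cong; prodFin-zero)
  open AlgProperties K U.alg using (·-zeroˡ; ·-zeroʳ)
  open import Algebra.Properties.CommutativeSemigroup U.+-commutativeSemigroup using (interchange)
  open import Relation.Binary.Reasoning.Setoid K.setoid

  record Linear (f : A.Carrier → U.Carrier) : Set (a ⊔ ℓa ⊔ c ⊔ ℓu) where
    field
      cong  : ∀ {x y} → x A.≈ y → f x U.≈ f y
      +-hom : ∀ x y → f (x A.+ y) U.≈ (f x U.+ f y)
      ·-hom : ∀ k x → f (k A.· x) U.≈ (k U.· f x)

  Linear-combination : ∀ {n} (coeff : Fin n → K.Carrier) (f : Fin n → A.Carrier → U.Carrier) →
    (∀ k → Linear (f k)) → Linear (λ x → U.sumFin (λ k → coeff k U.· f k x))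
  Linear-combination {zero} coeff f lin = record
    { cong  = λ _ → U.refl
    ; +-hom = λ _ _ → U.sym (U.+-identityʳ U.0#)
    ; ·-hom = λ k _ → U.sym (·-zeroʳ k)
    }
  Linear-combination {suc n} coeff f lin = record
    { cong  = λ x≈y → U.+-cong (U.·-cong K.refl (Linear.cong (lin zero) x≈y)) (Linear.cong rest x≈y)
    ; +-hom = λ x y → U.trans (U.+-cong (U.trans (U.·-cong K.refl (Linear.+-hom (lin zero) x y)) (U.·-distribˡ _ _ _))
                                        (Linear.+-hom rest x y))
                              (interchange _ _ _ _)
    ; ·-hom = λ k x → U.trans (U.+-cong (U.trans (U.·-cong K.refl (Linear.·-hom (lin zero) k x)) (·-swap _ k _))
                                        (Linear.·-hom rest k x))
                              (U.sym (U.·-distribˡ _ _ _))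
    }
    where
    rest = Linear-combination (λ k → coeff (suc k)) (λ k → f (suc k)) (λ k → lin (suc k))
    ·-swap : ∀ k l y → (k U.· (l U.· y)) U.≈ (l U.· (k U.· y))
    ·-swap k l y = U.trans (U.sym (U.·-assoc k l y)) (U.trans (U.·-cong (K.*-comm k l) U.refl) (U.·-assoc l k y))

  φ-zero : U.φ U.0# K.≈ K.0#
  φ-zero = K.trans (U.φ-cong (U.sym (·-zeroˡ U.0#))) (K.trans (U.φ-· K.0# U.0#) (K.zeroˡ _))

  φ-prod : ∀ {m} → U.Carrier → (Fin m → A.Carrier → U.Carrier) → Functional m
  φ-prod a R w = U.φ (a U.* U.prodFin (λ j → R j (w j)))

  φ-prod-multilinear : ∀ m a (R : Fin m → A.Carrier → U.Carrier) → (∀ j → Linear (R j)) → Multilinear m (φ-prod a R)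
  φ-prod-multilinear zero    a R lin = lift λ _ → K.refl
  φ-prod-multilinear (suc m) a R lin = cong , additive , homogeneous , rest
    where
    cong : Congruent (φ-prod a R)
    cong v≈w = U.φ-cong (U.*-congˡ (prodFin-cong λ j → Linear.cong (lin j) (v≈w j)))
    tail-prod : (Fin m → A.Carrier) → U.Carrier
    tail-prod w = U.prodFin (λ j → R (suc j) (w j))
    additive : ∀ x y w → φ-prod a R ((x A.+ y) V.∷ w) K.≈ (φ-prod a R (x V.∷ w) K.+ φ-prod a R (y V.∷ w))
    additive x y w = begin
      U.φ (a U.* (R zero (x A.+ y) U.* tail-prod w))
        ≈⟨ U.φ-cong (U.*-congˡ (U.*-congʳ (Linear.+-hom (lin zero) x y))) ⟩
      U.φ (a U.* ((R zero x U.+ R zero y) U.* tail-prod w))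
        ≈⟨ U.φ-cong (U.trans (U.*-congˡ (U.distribʳ _ _ _)) (U.distribˡ _ _ _)) ⟩
      U.φ ((a U.* (R zero x U.* tail-prod w)) U.+ (a U.* (R zero y U.* tail-prod w)))
        ≈⟨ U.φ-+ _ _ ⟩
      φ-prod a R (x V.∷ w) K.+ φ-prod a R (y V.∷ w) ∎
    homogeneous : ∀ k x w → φ-prod a R ((k A.· x) V.∷ w) K.≈ (k K.* φ-prod a R (x V.∷ w))
    homogeneous k x w = begin
      U.φ (a U.* (R zero (k A.· x) U.* tail-prod w))
        ≈⟨ U.φ-cong (U.*-congˡ (U.*-congʳ (Linear.·-hom (lin zero) k x))) ⟩
      U.φ (a U.* ((k U.· R zero x) U.* tail-prod w))
        ≈⟨ U.φ-cong (U.trans (U.*-congˡ (U.·-*ˡ _ _ _)) (U.·-*ʳ _ _ _)) ⟩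
      U.φ (k U.· (a U.* (R zero x U.* tail-prod w)))
        ≈⟨ U.φ-· _ _ ⟩
      k K.* φ-prod a R (x V.∷ w) ∎
    rest : ∀ x → Multilinear m (λ w → φ-prod a R (x V.∷ w))
    rest x = Multilinear-resp (λ w → U.φ-cong (U.*-assoc _ _ _))
                              (φ-prod-multilinear m (a U.* R zero x) (λ j → R (suc j)) (λ j → lin (suc j)))

  φ-prod-annihilatesUnit : ∀ m a (R : Fin m → A.Carrier → U.Carrier) → (∀ j → R j A.1# U.≈ U.0#) →
    AnnihilatesUnit m (φ-prod a R)
  φ-prod-annihilatesUnit m a R R1≈0 i v =
    K.trans (U.φ-cong (U.trans (U.*-congˡ (prodFin-zero _ i factor≈0)) (U.zeroʳ a))) φ-zero
    where
    factor≈0 : R i (updateAt v i (λ _ → A.1#) i) U.≈ U.0#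
    factor≈0 rewrite updateAt-updates i {λ _ → A.1#} v = R1≈0 i

module Exchangeability {c ℓ a ℓa u ℓu} (K : Field c ℓ) {P : Theory.NCPS K a ℓa} (E : Theory.ExchSystem K P u ℓu) where

  open import Data.Nat using (_<_)
  open import Data.Fin using (toℕ; _≟_)
  open import Data.Fin.Properties using (toℕ<n; toℕ-injective)
  open import Data.Product using (_,_)
  open import Data.Vec.Functional using (updateAt)
  open import Data.Vec.Functional.Properties using (updateAt-updates)
  open import Relation.Nullary using (yes; no)
  import Relation.Binary.PropositionalEquality as ≡
  open ≡ using (_≡_; _≢_)
  open Theory K
  open ExchSystem E
  private
    module P = NCPS P
    module U = NCPS U
  open Multilinearity K P.alg
  open ProductFunctionals K P.alg U
  open RestrictedGrowth using (SameKernel; kernel-permutation)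
  open FinSums U.ring using (sumFin-cong; prodFin-cong)
  open AlgProperties K U.alg using (·-zeroˡ; sumFin-·ʳ)
  open RootsOfUnity K using (powerSum; powerSum-vanishes)

  ι-linear : ∀ k → Linear (_⁽ k ⁾)
  ι-linear k = record { cong = Embedding.cong (ι k) ; +-hom = Embedding.hom-+ (ι k) ; ·-hom = Embedding.hom-· (ι k) }

  rootSum-linear : ∀ m ω → Linear (rootSum m ω)
  rootSum-linear m ω =
    Linear-combination {m} (λ k → powK ω (suc (toℕ k))) (λ k x → x ⁽ suc (toℕ k) ⁾) (λ _ → ι-linear _)

  rootSum-unit : ∀ m ω → PrimitiveRoot (suc (suc m)) ω → rootSum (suc (suc m)) ω P.1# U.≈ U.0#
  rootSum-unit m ω root = begin
    rootSum M ω P.1#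
      ≈⟨ sumFin-cong {M} (λ k → U.·-cong (K.refl {powK ω (suc (toℕ k))}) (Embedding.hom-1 (ι (suc (toℕ k))))) ⟩
    U.sumFin {M} (λ k → powK ω (suc (toℕ k)) U.· U.1#)
      ≈⟨ sumFin-·ʳ {M} (λ k → powK ω (suc (toℕ k))) U.1# ⟩
    powerSum ω M U.· U.1#
      ≈⟨ U.·-cong (powerSum-vanishes ω m root) U.refl ⟩
    K.0# U.· U.1#
      ≈⟨ ·-zeroˡ U.1# ⟩
    U.0# ∎
    where
    open import Relation.Binary.Reasoning.Setoid U.setoid
    M = suc (suc m)

  cumulant≈φ-prod : ∀ m ω minv v → cumulant m ω minv v K.≈ minv K.* φ-prod U.1# (λ _ → rootSum m ω) v
  cumulant≈φ-prod m ω minv v = K.*-congˡ (U.φ-cong (U.sym (U.*-identityˡ _)))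

  cumulant-multilinear : ∀ m ω minv → Multilinear m (cumulant m ω minv)
  cumulant-multilinear m ω minv =
    Multilinear-resp (λ v → K.sym (cumulant≈φ-prod m ω minv v))
      (Multilinear-*ˡ minv (φ-prod-multilinear m U.1# _ (λ _ → rootSum-linear m ω)))

  cumulant-annihilatesUnit : ∀ m ω minv → PrimitiveRoot (suc (suc m)) ω →
    AnnihilatesUnit (suc (suc m)) (cumulant (suc (suc m)) ω minv)
  cumulant-annihilatesUnit m ω minv root i v =
    K.trans (cumulant≈φ-prod M ω minv (updateAt v i (λ _ → P.1#)))
            (K.trans (K.*-congˡ (φ-prod-annihilatesUnit M U.1# (λ _ → rootSum M ω) (λ _ → rootSum-unit m ω root) i v))
                     (K.zeroʳ minv))
    where M = suc (suc m)

  φₚ≈φ-prod : ∀ m σ v → φₚ {m} σ v K.≈ φ-prod U.1# (λ j x → x ⁽ lab σ (toℕ j) ⁾) v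
  φₚ≈φ-prod m σ v = U.φ-cong (U.sym (U.*-identityˡ _))

  partCumulant-multilinear : ∀ m π → Multilinear m (partCumulant m π)
  partCumulant-multilinear m π = Multilinear-∑ (Partitions m) λ σ →
    Multilinear-if (refines m σ π) (Multilinear-*ʳ (mobius m σ π)
      (Multilinear-resp (λ v → K.sym (φₚ≈φ-prod m σ v)) (φ-prod-multilinear m U.1# _ (λ _ → ι-linear _))))

  partCumulant-annihilatesUnit : ∀ m π → π ∈ Partitions m → NoSingletons m π → AnnihilatesUnit m (partCumulant m π)
  partCumulant-annihilatesUnit (suc m′) π π∈ i-shares i v =
    Vanishing.κ-vanishes m′ (toℕ i) (toℕ<n i) H H-local H-kernel π∈ (i-shares (toℕ i) (toℕ<n i))
    where
    open Mobius K using (module Vanishing)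
    Z = updateAt v i (λ _ → P.1#)
    H : (ℕ → ℕ) → K.Carrier
    H ℓ = U.φ (U.prodFin (λ j → Z j ⁽ ℓ (toℕ j) ⁾))
    H-local : ∀ {ℓ ℓ′} → (∀ {j} → j < suc m′ → j ≢ toℕ i → ℓ j ≡ ℓ′ j) → H ℓ K.≈ H ℓ′
    H-local {ℓ} {ℓ′} agree = U.φ-cong (prodFin-cong factor)
      where
      factor : ∀ j → (Z j ⁽ ℓ (toℕ j) ⁾) U.≈ (Z j ⁽ ℓ′ (toℕ j) ⁾)
      factor j with j ≟ i
      ... | yes ≡.refl rewrite updateAt-updates i {λ _ → P.1#} v =
        U.trans (Embedding.hom-1 (ι _)) (U.sym (Embedding.hom-1 (ι _)))
      ... | no j≢i = U.reflexive (≡.cong (Z j ⁽_⁾) (agree (toℕ<n j) (λ e → j≢i (toℕ-injective e))))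
    H-kernel : ∀ {ℓ ℓ′} → SameKernel (suc m′) ℓ ℓ′ → H ℓ K.≈ H ℓ′
    H-kernel {ℓ} {ℓ′} same with kernel-permutation same
    ... | σ , σℓ≡ℓ′ = K.trans (exch _ Z (λ j → ℓ (toℕ j)) σ)
                              (U.φ-cong (prodFin-cong (λ j → U.reflexive (≡.cong (Z j ⁽_⁾) (σℓ≡ℓ′ (toℕ<n j))))))

proposition3p1 : ∀ {c ℓ a ℓa u ℓu} (K : Field c ℓ) (let open Theory K)
    (P : NCPS a ℓa) (E : ExchSystem P u ℓu)
    (m n : ℕ) → 2 ≤ m →
    (X : Fin n → NCPS.Carrier P) (α : Fin m → Fin n → K.Carrier) →
    let open ExchSystem E
        -- Y_i = Σ_j α_ij X_j + β_i 1
        Y : (Fin m → K.Carrier) → Fin m → NCPS.Carrier P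
        Y β i = NCPS._+_ P (NCPS.sumFin P (λ j → NCPS._·_ P (α i j) (X j)))
                           (NCPS._·_ P (β i) (NCPS.1# P))
    in
    (∀ (ω minv : K.Carrier) → PrimitiveRoot m ω → (minv K.* fromℕK m) K.≈ K.1# →
       (∀ (β β′ : Fin m → K.Carrier) →
          cumulant m ω minv (Y β) K.≈ cumulant m ω minv (Y β′))
       × (∀ (β : Fin m → K.Carrier) →
          cumulant m ω minv (Y β)
            K.≈ sumMultiK m n (λ j → prodK (λ i → α i (j i))
                                      K.* cumulant m ω minv (λ i → X (j i)))))
    × (∀ (π : List ℕ) → π ∈ Partitions m → NoSingletons m π →
         ∀ (β : Fin m → K.Carrier) →
         partCumulant m π (Y β)
           K.≈ sumMultiK m n (λ j → prodK (λ i → α i (j i))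
                                     K.* partCumulant m π (λ i → X (j i))))
proposition3p1 K P E (suc (suc m)) n (s≤s (s≤s z≤n)) X α =
  -- The normalisation minv is irrelevant: both claims are linear in the cumulant.
  (λ ω minv root _ →
     let expand-cumulant = affine-expand M (cumulant-multilinear M ω minv)
                                           (cumulant-annihilatesUnit m ω minv root) α X in
     (λ β β′ → K.trans (expand-cumulant β) (K.sym (expand-cumulant β′))) , expand-cumulant) ,
  (λ π π∈ no-singletons →
     affine-expand M (partCumulant-multilinear M π) (partCumulant-annihilatesUnit M π π∈ no-singletons) α X)
  where
  open Theory K
  open Exchangeability K E
  open Multilinearity K (NCPS.alg P) using (affine-expand)
  M = suc (suc m)
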